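{- Let $G$ be a digraph. Let $\Phi_1:\mathcal T\langle\mathcal W(G)\rangle\to\mathcal T\langle\mathrm{Cact}(K_{\mathbb N})\rangle/\mathcal J_1$ and $\Phi_2:\mathcal S\langle\mathcal W(G)\rangle\to\mathcal S\langle\mathrm{Cact}(K_{\mathbb N})\rangle/\mathcal J_2$ be the algebra morphisms sending each walk $\omega$ to the class of $C(\omega)$ (the unlabeled cactus obtained from $C(\omega)$ by forgetting its node labels). Then $\Phi_1$ and $\Phi_2$ are Hopf algebra morphisms.
   Context: A digraph is $G=(V,E)$ with $E\subseteq V\times V$; a walk is $\omega=w_0\cdots w_\ell$ with $(w_{i-1},w_i)\in E$; vertex labels are regarded as natural numbers. Lawler loop erasure: $\mathrm{LEW}_0(\omega)=w_0$; if $w_{k+1}$ does not occur in $\mathrm{LEW}_k(\omega)$ then $\mathrm{LEW}_{k+1}(\omega)=\mathrm{LEW}_k(\omega)w_{k+1}$, else it is the prefix of $\mathrm{LEW}_k(\omega)$ ending at its occurrence of $w_{k+1}$. $\mathrm{LES}(\omega)$ (index pairs): start with $\emptyset$; for $k=0,\dots,\ell-1$ in order, if $w_{k+1}$ occurs in $\mathrm{LEW}_k(\omega)$, let $k'$ be the largest index $\le k$ with $w_{k'}=w_{k+1}$; add $(k',k+1)$, and for each $(k'',k')$ already present add $(k'',k+1)$. $\mathrm{AdC}(\omega)$: pairs $(k,k')\in\mathrm{LES}(\omega)$ with $(k,k')\ne(0,\ell)$ such that either no $(l,l')\in\mathrm{LES}(\omega)$ has $l\le k<k'<l'$, or, with $(l,l')$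 the smallest such for inclusion, $w_k$ does not occur in $w_{k'+1}\cdots w_{l'}$. $E\mathrm{AdC}(\omega)$: sets $\{(k_1,k_1'),\dots,(k_n,k_n')\}$, $n\ge1$, of admissible cuts with $k_1<k_1'<\dots<k_n<k_n'$; $\omega^c:=w_{k_1}\cdots w_{k_1'}|\cdots|w_{k_n}\cdots w_{k_n'}$, $\omega_c$ the walk with positions $k_i+1,\dots,k_i'$ removed. For any digraph $H$, $\mathcal W(H)$ is the span (field of characteristic $0$) of walks on $H$, $\mathcal T\langle\cdot\rangle$ the tensor algebra (concatenation) with the Hopf coproduct $\Delta_{\mathrm H}$, the algebra morphism with $\Delta_{\mathrm H}(\omega)=\mathbf1\otimes\omega+\omega\otimes\mathbf1+\sum_{c\in E\mathrm{AdC}(\omega)}\omega_c\otimes\omega^c$, and $\mathcal S\langle\cdot\rangle$ the symmetric quotient (by the span of $\omega_1|\cdots|\omega_n-\omega_{\sigma(1)}|\cdots|\omega_{\sigma(n)}$) with product $\Box$. $K_{\mathbb N}$ is the complete digraph on $\mathbb N$ with all arcs (loops included). A cactus is a walk with $w_k=w_{k'}\iff(k,k')\in\mathrm{LES}(\omega)$ for all $k<k'$; $\mathrm{Cact}(K_{\mathbb N})$ is their span. With $\mathcal I_{\mathbb N}$ the injective maps $\mathbb N\to\mathbb N$ and $f(\omega)=f(w_0)\cdots f(w_\ell)$: $\mathcal J_1$ is the span of $\omega_1|\cdots|\omega_n-f_1(\omega_1)|\cdots|f_n(\omega_n)$ and $\mathcal J_2$ the span of $\omega_1\Box\cdots\Box\omega_n-f_1(\omega_1)\Box\cdots\Box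 f_n(\omega_n)$ ($\omega_i$ cacti on $K_{\mathbb N}$, $f_i\in\mathcal I_{\mathbb N}$); they are Hopf bi-ideals. The cactus map: for $\omega=w_0\cdots w_\ell$, $C(\omega)=c_0\cdots c_\ell$ with $c_0=w_0$ and, for $0\le k<\ell$, if $\mathrm{LEW}_{k+1}(\omega)=\mathrm{LEW}_k(\omega)w_{k+1}$ then $c_{k+1}=\max\{c_0,\dots,c_k\}+1$, else $c_{k+1}=c_l$ with $l=\max\{i\le k: w_i=w_{k+1}\}$. -}

module Defs where

open import Level using (Level; _⊔_) renaming (suc to lsuc)
open import Data.Bool using (Bool; true; false; if_then_else_; _∧_; _∨_; not)
open import Data.Nat using (ℕ; zero; suc; _∸_; _≤_; _<_; _≡ᵇ_; _≤ᵇ_; _<ᵇ_) renaming (_⊔_ to _⊔ℕ_)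
  renaming (_≟_ to _≟ℕ_)
open import Data.List using (List; []; _∷_; _++_; [_]; map; concatMap; filter; foldr;
  length; take; drop; upTo; null; zip)
open import Data.List.Relation.Unary.All using (All)
open import Data.List.Relation.Unary.Linked using (Linked)
open import Data.List.Relation.Binary.Permutation.Propositional using (_↭_)
import Data.List.Properties as LP
import Data.Product.Properties as PP
open import Data.Product using (Σ; ∃; _×_; _,_; proj₁; proj₂)
open import Data.Sum using (_⊎_; inj₁; inj₂)
open import Relation.Nullary using (¬_; Dec; yes; no)
open import Relation.Binary.PropositionalEquality using (_≡_; _≢_)
open import Relation.Binary.Definitions using (DecidableEquality)
open import Function.Definitions using (Injective)
open import Function.Bundles using (_⇔_)
open import Algebra.Bundles using (CommutativeRing)

-- Walks.  Vertex labels are natural numbers; a walk w₀⋯w_ℓ is the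
-- (nonempty) list [w₀, …, w_ℓ].  A word ω₁|⋯|ωₙ of the tensor algebra
-- is a list of walks (the empty word is the unit 𝟏).

Walk : Set
Walk = List ℕ

Word : Set
Word = List Walk

bfilter : {A : Set} → (A → Bool) → List A → List A
bfilter p []       = []
bfilter p (x ∷ xs) = if p x then x ∷ bfilter p xs else bfilter p xs

any : {A : Set} → (A → Bool) → List A → Bool
any p []       = false
any p (x ∷ xs) = p x ∨ any p xs

all : {A : Set} → (A → Bool) → List A → Bool
all p []       = true
all p (x ∷ xs) = p x ∧ all p xs

record Digraph : Set₁ where
  field
    V     : ℕ → Set
    E     : ℕ → ℕ → Set
    E⊆V×V : ∀ u v → E u v → V u × V v

IsWalk : Digraph → Walk → Set
IsWalk G ω = ω ≢ [] × All (Digraph.V G) ω × Linked (Digraph.E G) ω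

-- position access w_k (default 0 outside the walk), last index ℓ
at : Walk → ℕ → ℕ
at []       _       = 0
at (x ∷ _)  zero    = x
at (_ ∷ xs) (suc k) = at xs k

lastIx : Walk → ℕ
lastIx ω = length ω ∸ 1

elem : ℕ → List ℕ → Bool
elem x = any (λ y → x ≡ᵇ y)

prefixTo : ℕ → List ℕ → List ℕ
prefixTo x []       = []
prefixTo x (y ∷ ys) = if x ≡ᵇ y then [ y ] else y ∷ prefixTo x ys

LEW : Walk → ℕ → List ℕ
LEW ω zero    = [ at ω 0 ]
LEW ω (suc k) = let L = LEW ω k ; x = at ω (suc k) in
  if elem x L then prefixTo x L else L ++ [ x ]

-- largest index i ≤ k with w_i = x  (0 if none)
lastOcc : Walk → ℕ → ℕ → ℕ
lastOcc ω x zero    = 0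
lastOcc ω x (suc k) = if at ω (suc k) ≡ᵇ x then suc k else lastOcc ω x k

Pair : Set
Pair = ℕ × ℕ

pairEq : Pair → Pair → Bool
pairEq (a , b) (c , d) = (a ≡ᵇ c) ∧ (b ≡ᵇ d)

LESupto : Walk → ℕ → List Pair
LESupto ω zero    = []
LESupto ω (suc k) =
  let S = LESupto ω k ; x = at ω (suc k) in
  if elem x (LEW ω k)
  then (let k' = lastOcc ω x k in
        S ++ ((k' , suc k) ∷ map (λ p → proj₁ p , suc k)
                                 (bfilter (λ p → proj₂ p ≡ᵇ k') S)))
  else S

LES : Walk → List Pair
LES ω = LESupto ω (lastIx ω)

inLES : Walk → ℕ → ℕ → Bool
inLES ω k k' = any (pairEq (k , k')) (LES ω)

slice : Walk → ℕ → ℕ → Walk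
slice ω a b = take (suc b ∸ a) (drop a ω)

allPairs : ℕ → List Pair
allPairs ℓ = concatMap (λ k → map (λ k' → k , k')
                          (bfilter (λ k' → k <ᵇ k') (upTo (suc ℓ))))
                       (upTo (suc ℓ))

-- admissibility of (k , k') ∈ LES(ω).
-- The pairs (l , l') ∈ LES(ω) with l ≤ k < k' < l' are the "containing" pairs;
-- the condition is checked for the inclusion-minimal containing pairs.
admissible : Walk → Pair → Bool
admissible ω (k , k') =
  let L   = LES ω
      Cn  = bfilter (λ p → (proj₁ p ≤ᵇ k) ∧ (k' <ᵇ proj₂ p)) L
      minimal : Pair → Bool
      minimal p = not (any (λ q → not (pairEq q p) ∧ (proj₁ p ≤ᵇ proj₁ q)
                                  ∧ (proj₂ q ≤ᵇ proj₂ p)) Cn)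
      ok : Pair → Bool
      ok p = if minimal p
             then not (elem (at ω k) (slice ω (suc k') (proj₂ p)))
             else true
  in inLES ω k k' ∧ not ((k ≡ᵇ 0) ∧ (k' ≡ᵇ lastIx ω)) ∧ all ok Cn

AdC : Walk → List Pair
AdC ω = bfilter (admissible ω) (allPairs (lastIx ω))

-- increasing chains (k₁,k₁'),…,(kₙ,kₙ') with k₁<k₁'<k₂<⋯<kₙ<kₙ' of elements of L
chains : ℕ → (ℕ → Bool) → List Pair → List (List Pair)
chains zero    ok L = [ [] ]
chains (suc n) ok L = [] ∷ concatMap (λ p → if ok (proj₁ p)
                         then map (p ∷_) (chains n (λ a → proj₂ p <ᵇ a) L)
                         else []) L

EAdC : Walk → List (List Pair)
EAdC ω = let L = AdC ω in
  bfilter (λ c → not (null c)) (chains (length L) (λ _ → true) L)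

upperCut : Walk → List Pair → Word
upperCut ω c = map (λ p → slice ω (proj₁ p) (proj₂ p)) c

lowerCut : Walk → List Pair → Walk
lowerCut ω c = map proj₂ (bfilter
  (λ iw → not (any (λ p → (proj₁ p <ᵇ proj₁ iw) ∧ (proj₁ iw ≤ᵇ proj₂ p)) c))
  (zip (upTo (length ω)) ω))

IsCactus : Walk → Set
IsCactus ω = ω ≢ [] ×
  (∀ k k' → k < k' → k' ≤ lastIx ω → (at ω k ≡ at ω k' ⇔ inLES ω k k' ≡ true))

Cactus : Set
Cactus = Σ Walk IsCactus

maxList : List ℕ → ℕ
maxList = foldr _⊔ℕ_ 0

cactusUpto : Walk → ℕ → List ℕ
cactusUpto ω zero    = [ at ω 0 ]
cactusUpto ω (suc k) =
  let cs = cactusUpto ω k ; x = at ω (suc k) in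
  cs ++ [ (if elem x (LEW ω k) then at cs (lastOcc ω x k) else suc (maxList cs)) ]

C : Walk → Walk
C ω = cactusUpto ω (lastIx ω)

_≟W_ : DecidableEquality Word
_≟W_ = LP.≡-dec (LP.≡-dec _≟ℕ_)

_≟WW_ : DecidableEquality (Word × Word)
_≟WW_ = PP.≡-dec _≟W_ _≟W_

-- Linear algebra over a commutative ring R: elements of the free module on
-- a basis B are finite formal combinations (lists of coefficient/basis pairs);
-- two such are equal iff all their coefficients agree.

module Over {c ℓ : Level} (R : CommutativeRing c ℓ) where
  open CommutativeRing R

  LC : Set → Set c
  LC B = List (Carrier × B)

  coeff : {B : Set} → DecidableEquality B → LC B → B → Carrier
  coeff _≟_ []             b = 0#
  coeff _≟_ ((r , b') ∷ x) b with b' ≟ b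
  ... | yes _ = r + coeff _≟_ x b
  ... | no  _ = coeff _≟_ x b

  scale : {B : Set} → Carrier → LC B → LC B
  scale r = map (λ t → r * proj₁ t , proj₂ t)

  combo : {B Gen : Set} → (Gen → LC B) → LC Gen → LC B
  combo gen = concatMap (λ t → scale (proj₁ t) (gen (proj₂ t)))

  EqMod : {B : Set} → DecidableEquality B → (Gen : Set) → (Gen → LC B) →
          LC B → LC B → Set (c ⊔ ℓ)
  EqMod _≟_ Gen gen x y = Σ (LC Gen) λ cs →
    ∀ b → coeff _≟_ x b ≈ coeff _≟_ y b + coeff _≟_ (combo gen cs) b

  -- T⟨·⟩ = LC Word ,  T⟨·⟩ ⊗ T⟨·⟩ = LC (Word × Word)
  TT : Set c
  TT = LC (Word × Word)

  mulTT : TT → TT → TT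
  mulTT x y = concatMap (λ s → map (λ t → proj₁ s * proj₁ t ,
      (proj₁ (proj₂ s) ++ proj₁ (proj₂ t) , proj₂ (proj₂ s) ++ proj₂ (proj₂ t))) y) x

  oneTT : TT
  oneTT = [ (1# , ([] , [])) ]

  ΔWalk : Walk → TT
  ΔWalk ω = (1# , ([] , [ ω ])) ∷ (1# , ([ ω ] , [])) ∷
            map (λ cut → 1# , ([ lowerCut ω cut ] , upperCut ω cut)) (EAdC ω)

  ΔWord : Word → TT
  ΔWord = foldr (λ ω acc → mulTT (ΔWalk ω) acc) oneTT

  Δ : LC Word → TT
  Δ = combo ΔWord

  ε : LC Word → Carrier
  ε x = coeff _≟W_ x []

  Φ : LC Word → LC Word
  Φ = map (λ t → proj₁ t , map C (proj₂ t))

  Φ⊗Φ : TT → TT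
  Φ⊗Φ = map (λ t → proj₁ t , (map C (proj₁ (proj₂ t)) , map C (proj₂ (proj₂ t))))

  -- generators of 𝒥₁ : ω₁|⋯|ωₙ − f₁(ω₁)|⋯|fₙ(ωₙ), ωᵢ cacti, fᵢ injective
  J₁Gen : Set
  J₁Gen = List (Cactus × Σ (ℕ → ℕ) (Injective _≡_ _≡_))

  J₁gen : J₁Gen → LC Word
  J₁gen g = (1# , map (λ t → proj₁ (proj₁ t)) g)
          ∷ (- 1# , map (λ t → map (proj₁ (proj₂ t)) (proj₁ (proj₁ t))) g) ∷ []

  SymGen : Set
  SymGen = Σ (Word × Word) λ uv → All IsCactus (proj₁ uv) × (proj₁ uv ↭ proj₂ uv)

  symGen : SymGen → LC Word
  symGen ((u , v) , _) = (1# , u) ∷ (- 1# , v) ∷ []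

  -- the ideal defining 𝒮⟨Cact⟩/𝒥₂ inside 𝒯⟨Cact⟩ (𝒥₂ pulled back to 𝒯)
  J₂Gen : Set
  J₂Gen = SymGen ⊎ J₁Gen

  J₂gen : J₂Gen → LC Word
  J₂gen (inj₁ g) = symGen g
  J₂gen (inj₂ g) = J₁gen g

  tensorGen : {Gen : Set} → (Gen → LC Word) → (Gen × Word) ⊎ (Word × Gen) → TT
  tensorGen gen (inj₁ (g , u)) = map (λ t → proj₁ t , (proj₂ t , u)) (gen g)
  tensorGen gen (inj₂ (u , g)) = map (λ t → proj₁ t , (u , proj₂ t)) (gen g)

  -- equality in (𝒯/I) ⊗ (𝒯/I) , resp. in 𝒯/I
  EqTT : (Gen : Set) → (Gen → LC Word) → TT → TT → Set (c ⊔ ℓ)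
  EqTT Gen gen = EqMod _≟WW_ ((Gen × Word) ⊎ (Word × Gen)) (tensorGen gen)

  -- elements of 𝒯⟨𝒲(G)⟩ (all walks occurring are walks on G)
  OnG : Digraph → LC Word → Set c
  OnG G x = All (λ t → All (IsWalk G) (proj₂ t)) x

  -- Φ (into 𝒯/I) is compatible with coproduct and counit on 𝒯⟨𝒲(G)⟩
  -- (it is an algebra morphism by construction); i.e. a bialgebra, hence
  -- Hopf algebra, morphism.
  IsHopfMorphismΦ : Digraph → (Gen : Set) → (Gen → LC Word) → Set (c ⊔ ℓ)
  IsHopfMorphismΦ G Gen gen = ∀ x → OnG G x →
    EqTT Gen gen (Δ (Φ x)) (Φ⊗Φ (Δ x)) × (ε (Φ x) ≈ ε x)

natCast : {c ℓ : Level} (R : CommutativeRing c ℓ) → ℕ → CommutativeRing.Carrier R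
natCast R zero    = CommutativeRing.0# R
natCast R (suc n) = CommutativeRing._+_ R (CommutativeRing.1# R) (natCast R n)

record IsFieldChar0 {c ℓ : Level} (R : CommutativeRing c ℓ) : Set (c ⊔ ℓ) where
  open CommutativeRing R
  field
    nontrivial : ¬ (1# ≈ 0#)
    inverse    : ∀ x → ¬ (x ≈ 0#) → Σ Carrier λ y → x * y ≈ 1#
    char0      : ∀ n → ¬ (natCast R (suc n) ≈ 0#)

{-# OPTIONS --safe #-}
-- Step k+1 of Lawler's loop erasure either appends w_{k+1} or erases back to the last
-- occurrence q of w_{k+1}; the pairs (q , k+1) form a forest on positions whose ancestor
-- relation is LES(ω). C(ω) gives w_{k+1} the label of w_q in the second case and a fresh one
-- in the first, so two positions of C(ω) carry the same label exactly when they are related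
-- in that forest. Hence C(ω) is a cactus with LES(C ω) = LES(ω). Admissibility of a cut
-- (k , k') only asks whether w_k recurs inside the minimal LES pair containing it, and inside
-- that pair such a recurrence is itself an LES pair, so AdC(C ω) = AdC(ω).
-- Every piece of a lower or upper cut of ω is a walk whose LES is the restriction of LES(ω)
-- (skipping a loop does not change the erased walk), so C of the piece and the corresponding
-- piece of C(ω) have the same pattern of repeated labels: they differ by an injective
-- relabelling of a cactus. Thus Δ(Φ x) and (Φ ⊗ Φ)(Δ x) agree term by term modulo
-- 𝒥₁ ⊗ 𝒯 + 𝒯 ⊗ 𝒥₁, over any commutative ring;
-- 𝒥₁ ⊆ 𝒥₂ gives the symmetric case, and the counit only sees the empty word.
module Submission where

open import Defs
open import Level using (Level)
open import Data.Bool using (Bool; true; false; if_then_else_; _∧_; not; T)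
open import Data.Bool.Properties using (∧-zeroʳ)
open import Data.List using (List; []; _∷_; _++_; [_]; map; length; take; drop; upTo; applyUpTo; zip; null)
open import Data.List.Properties using (map-cong-local; ++-assoc; map-++; length-++; length-map; length-take; length-drop; map-upTo; map-∘; concatMap-++; ++-identityʳ)
open import Data.List.Membership.Propositional using (_∈_; _∉_; find)
open import Data.List.Membership.Propositional.Properties using (∈-++⁺ˡ; ∈-++⁺ʳ; ∈-++⁻; ∈-map⁺; ∈-map⁻; ∈-upTo⁺; ∈-upTo⁻; ∈-concatMap⁻)
open import Data.List.Relation.Unary.Any using (here; there; any?)
import Data.List.Relation.Unary.All as All
open import Data.List.Relation.Unary.AllPairs using (AllPairs; []; _∷_)
import Data.List.Relation.Unary.AllPairs.Properties as AllPairs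
open import Data.List.Relation.Unary.Linked using (Linked; []; [-]; _∷_)
import Data.List.Relation.Unary.Linked as Linked
open import Data.Product using (Σ; _×_; _,_; proj₁; proj₂)
open import Function.Base using (_∘_)
open import Function.Bundles using (mk⇔)
open import Function.Definitions using (Injective)
open import Data.Sum using (_⊎_; inj₁; inj₂)
open import Data.Empty using (⊥; ⊥-elim)
open import Relation.Nullary using (¬_; yes; no)
open import Relation.Binary.Definitions using (tri<; tri≈; tri>; DecidableEquality)
open import Data.List.Relation.Binary.Pointwise using (Pointwise; []; _∷_; ++⁺)
open import Algebra.Bundles using (CommutativeRing)
import Algebra.Properties.Ring as RingProperties
import Algebra.Properties.CommutativeSemigroup as CommutativeSemigroupProperties
import Relation.Binary.Reasoning.Setoid as SetoidReasoning
open import Relation.Binary.Construct.Closure.Transitive using (TransClosure; _∷ʳ_) renaming ([_] to [_]⁺; _∷_ to _◅_)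
open import Relation.Binary.PropositionalEquality using (_≡_; _≢_; refl; sym; trans; cong; cong₂; subst; subst₂; module ≡-Reasoning)

module LoopErasure where

  open import Data.Nat using (ℕ; zero; suc; _+_; _∸_; _⊓_; _≤_; _<_; _≡ᵇ_; _≤ᵇ_; _<ᵇ_; z≤n; s≤s; _≤?_; _<?_)
    renaming (_≟_ to _≟ℕ_)
  open import Data.Nat.Properties using (+-cancelˡ-≡; +-comm; +-identityʳ; +-monoʳ-<; +-monoʳ-≤; +-suc; +-∸-assoc;
    <-cmp; <-irrefl; <-trans; <-≤-trans; <ᵇ⇒<; <⇒<ᵇ; <⇒≢; <⇒≤; m+[n∸m]≡n; m+n∸m≡n; m≤m+n; m≤n⇒m<n∨m≡n;
    m≤n⇒m≤1+n; m≤n⇒m⊓n≡m; m≤m⊔n; m≤n⊔m; n<1+n; n≤0⇒n≡0; n≤1+n; n≮0; suc-injective; ∸-monoˡ-<; ∸-monoˡ-≤;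
    ≡ᵇ⇒≡; ≡⇒≡ᵇ; ≤-<-trans; ≤-antisym; ≤-pred; ≤-refl; ≤-trans; ≤ᵇ⇒≤; ≤⇒≤ᵇ; ≤∧≢⇒<; ≮⇒≥; ≰⇒>)

  ≡ᵇ-true⇒≡ : ∀ m n → (m ≡ᵇ n) ≡ true → m ≡ n
  ≡ᵇ-true⇒≡ m n e = ≡ᵇ⇒≡ m n (subst T (sym e) _)

  ≡⇒≡ᵇ-true : ∀ m n → m ≡ n → (m ≡ᵇ n) ≡ true
  ≡⇒≡ᵇ-true m n e with m ≡ᵇ n | ≡⇒≡ᵇ m n e
  ... | true | _ = refl

  ≡ᵇ-refl : ∀ n → (n ≡ᵇ n) ≡ true
  ≡ᵇ-refl n = ≡⇒≡ᵇ-true n n refl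

  ≡ᵇ-false⇒≢ : ∀ m n → (m ≡ᵇ n) ≡ false → m ≢ n
  ≡ᵇ-false⇒≢ m n e m≡n with () ← trans (sym e) (≡⇒≡ᵇ-true m n m≡n)

  ≢⇒≡ᵇ-false : ∀ m n → m ≢ n → (m ≡ᵇ n) ≡ false
  ≢⇒≡ᵇ-false m n m≢n with m ≡ᵇ n in e
  ... | true  = ⊥-elim (m≢n (≡ᵇ-true⇒≡ m n e))
  ... | false = refl

  T⇒≡true : ∀ {b} → T b → b ≡ true
  T⇒≡true {true} _ = refl

  ≡true⇒T : ∀ {b} → b ≡ true → T b
  ≡true⇒T refl = _

  <ᵇ-true⇒< : ∀ m n → (m <ᵇ n) ≡ true → m < n
  <ᵇ-true⇒< m n e = <ᵇ⇒< m n (≡true⇒T e)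

  <⇒<ᵇ-true : ∀ {m n} → m < n → (m <ᵇ n) ≡ true
  <⇒<ᵇ-true m<n = T⇒≡true (<⇒<ᵇ m<n)

  ≤ᵇ-true⇒≤ : ∀ m n → (m ≤ᵇ n) ≡ true → m ≤ n
  ≤ᵇ-true⇒≤ m n e = ≤ᵇ⇒≤ m n (≡true⇒T e)

  ≤⇒≤ᵇ-true : ∀ {m n} → m ≤ n → (m ≤ᵇ n) ≡ true
  ≤⇒≤ᵇ-true m≤n = T⇒≡true (≤⇒≤ᵇ m≤n)

  true-or-false : ∀ b → (b ≡ true) ⊎ (b ≡ false)
  true-or-false true  = inj₁ refl
  true-or-false false = inj₂ refl

  ∧-true⁻ : ∀ {a b} → (a ∧ b) ≡ true → (a ≡ true) × (b ≡ true)
  ∧-true⁻ {true} {true} _ = refl , refl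

  false≢true : false ≢ true
  false≢true ()

  not-true⇒false : ∀ {b} → not b ≡ true → b ≡ false
  not-true⇒false {false} _ = refl

  not-false⇒true : ∀ {b} → not b ≡ false → b ≡ true
  not-false⇒true {true} _ = refl

  true⇔true⇒≡ : ∀ {a b : Bool} → (a ≡ true → b ≡ true) → (b ≡ true → a ≡ true) → a ≡ b
  true⇔true⇒≡ {false} {false} _ _ = refl
  true⇔true⇒≡ {false} {true}  _ g = g refl
  true⇔true⇒≡ {true}  {false} f _ = sym (f refl)
  true⇔true⇒≡ {true}  {true}  _ _ = refl

  any⁺ : ∀ {A : Set} (f : A → Bool) xs {q} → q ∈ xs → f q ≡ true → any f xs ≡ true
  any⁺ f (x ∷ xs) (here refl) fq rewrite fq = refl
  any⁺ f (x ∷ xs) (there q∈xs) fq with f x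
  ... | true  = refl
  ... | false = any⁺ f xs q∈xs fq

  any⁻ : ∀ {A : Set} (f : A → Bool) xs → any f xs ≡ true → Σ A λ q → (q ∈ xs) × (f q ≡ true)
  any⁻ f (x ∷ xs) e with f x in fx
  ... | true  = x , here refl , fx
  ... | false = let (q , q∈xs , fq) = any⁻ f xs e in q , there q∈xs , fq

  all-cong : ∀ {A : Set} (f g : A → Bool) xs → (∀ x → x ∈ xs → f x ≡ g x) → all f xs ≡ all g xs
  all-cong f g []       _ = refl
  all-cong f g (x ∷ xs) h = cong₂ _∧_ (h x (here refl)) (all-cong f g xs (λ y y∈xs → h y (there y∈xs)))

  bfilter⁺ : ∀ {A : Set} (p : A → Bool) xs {x} → x ∈ xs → p x ≡ true → x ∈ bfilter p xs
  bfilter⁺ p (y ∷ xs) (here refl) px rewrite px = here refl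
  bfilter⁺ p (y ∷ xs) (there x∈xs) px with p y
  ... | true  = there (bfilter⁺ p xs x∈xs px)
  ... | false = bfilter⁺ p xs x∈xs px

  bfilter⁻ : ∀ {A : Set} (p : A → Bool) xs {x} → x ∈ bfilter p xs → (x ∈ xs) × (p x ≡ true)
  bfilter⁻ p (y ∷ xs) x∈ with p y in py
  bfilter⁻ p (y ∷ xs) (here refl) | true = here refl , py
  bfilter⁻ p (y ∷ xs) (there x∈) | true = let (x∈xs , px) = bfilter⁻ p xs x∈ in there x∈xs , px
  bfilter⁻ p (y ∷ xs) x∈ | false = let (x∈xs , px) = bfilter⁻ p xs x∈ in there x∈xs , px

  bfilter-cong : ∀ {A : Set} (f g : A → Bool) xs → (∀ x → f x ≡ g x) → bfilter f xs ≡ bfilter g xs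
  bfilter-cong f g []       h = refl
  bfilter-cong f g (x ∷ xs) h rewrite h x with g x
  ... | true  = cong (x ∷_) (bfilter-cong f g xs h)
  ... | false = bfilter-cong f g xs h

  bfilter-map : ∀ {A : Set} (p : A → Bool) (g : ℕ → A) xs → bfilter p (map g xs) ≡ map g (bfilter (λ i → p (g i)) xs)
  bfilter-map p g []       = refl
  bfilter-map p g (x ∷ xs) with p (g x)
  ... | true  = cong (g x ∷_) (bfilter-map p g xs)
  ... | false = bfilter-map p g xs

  elem⇒∈ : ∀ x xs → elem x xs ≡ true → x ∈ xs
  elem⇒∈ x (y ∷ xs) e with x ≡ᵇ y in x≡ᵇy
  ... | true  = here (≡ᵇ-true⇒≡ x y x≡ᵇy)
  ... | false = there (elem⇒∈ x xs e)

  ∈⇒elem : ∀ x xs → x ∈ xs → elem x xs ≡ true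
  ∈⇒elem x (y ∷ xs) (here x≡y) rewrite ≡⇒≡ᵇ-true x y x≡y = refl
  ∈⇒elem x (y ∷ xs) (there x∈xs) with x ≡ᵇ y
  ... | true  = refl
  ... | false = ∈⇒elem x xs x∈xs

  elem-false⇒∉ : ∀ x xs → elem x xs ≡ false → x ∉ xs
  elem-false⇒∉ x xs e x∈xs with () ← trans (sym e) (∈⇒elem x xs x∈xs)

  ∉⇒elem-false : ∀ x xs → x ∉ xs → elem x xs ≡ false
  ∉⇒elem-false x xs x∉xs with elem x xs in e
  ... | true  = ⊥-elim (x∉xs (elem⇒∈ x xs e))
  ... | false = refl

  elem-++ʳ : ∀ x xs ys → x ∉ xs → elem x (xs ++ ys) ≡ elem x ys
  elem-++ʳ x []       ys _ = refl
  elem-++ʳ x (y ∷ xs) ys x∉ with x ≡ᵇ y in e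
  ... | true  = ⊥-elim (x∉ (here (≡ᵇ-true⇒≡ x y e)))
  ... | false = elem-++ʳ x xs ys (λ x∈xs → x∉ (there x∈xs))

  any-pairEq⇒∈ : ∀ a b ps → any (pairEq (a , b)) ps ≡ true → (a , b) ∈ ps
  any-pairEq⇒∈ a b ((c , d) ∷ ps) e with (a ≡ᵇ c) ∧ (b ≡ᵇ d) in eq
  ... | false = there (any-pairEq⇒∈ a b ps e)
  ... | true with ∧-true⁻ {a ≡ᵇ c} eq
  ...   | a≡ᵇc , b≡ᵇd rewrite ≡ᵇ-true⇒≡ a c a≡ᵇc | ≡ᵇ-true⇒≡ b d b≡ᵇd = here refl

  ∈⇒any-pairEq : ∀ a b ps → (a , b) ∈ ps → any (pairEq (a , b)) ps ≡ true
  ∈⇒any-pairEq a b ps ab∈ = any⁺ (pairEq (a , b)) ps ab∈ (cong₂ _∧_ (≡ᵇ-refl a) (≡ᵇ-refl b))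

  at-++ˡ : ∀ xs ys {i} → i < length xs → at (xs ++ ys) i ≡ at xs i
  at-++ˡ (x ∷ xs) ys {zero}  _         = refl
  at-++ˡ (x ∷ xs) ys {suc i} (s≤s i<) = at-++ˡ xs ys i<

  at-++-length : ∀ xs y ys → at (xs ++ y ∷ ys) (length xs) ≡ y
  at-++-length []       y ys = refl
  at-++-length (x ∷ xs) y ys = at-++-length xs y ys

  at∈ : ∀ xs {i} → i < length xs → at xs i ∈ xs
  at∈ (x ∷ xs) {zero}  _         = here refl
  at∈ (x ∷ xs) {suc i} (s≤s i<) = there (at∈ xs i<)

  at-map : ∀ (f : ℕ → ℕ) xs {i} → i < length xs → at (map f xs) i ≡ f (at xs i)
  at-map f (x ∷ xs) {zero}  _         = refl
  at-map f (x ∷ xs) {suc i} (s≤s i<) = at-map f xs i<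

  at-drop : ∀ (xs : List ℕ) a i → at (drop a xs) i ≡ at xs (a + i)
  at-drop xs       zero    i = refl
  at-drop []       (suc a) i = refl
  at-drop (x ∷ xs) (suc a) i = at-drop xs a i

  at-take : ∀ n (xs : List ℕ) {i} → i < n → at (take n xs) i ≡ at xs i
  at-take (suc n) []       {i}     _         = refl
  at-take (suc n) (x ∷ xs) {zero}  _         = refl
  at-take (suc n) (x ∷ xs) {suc i} (s≤s i<) = at-take n xs i<

  ∈-take⁻ : ∀ n (xs : List ℕ) {x} → x ∈ take n xs → Σ ℕ λ i → (i < n) × (at xs i ≡ x)
  ∈-take⁻ (suc n) (y ∷ xs) (here refl) = 0 , s≤s z≤n , refl
  ∈-take⁻ (suc n) (y ∷ xs) (there x∈) = let (i , i<n , e) = ∈-take⁻ n xs x∈ in suc i , s≤s i<n , e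

  at∈take : ∀ n (xs : List ℕ) {i} → i < n → i < length xs → at xs i ∈ take n xs
  at∈take (suc n) (y ∷ xs) {zero}  _          _          = here refl
  at∈take (suc n) (y ∷ xs) {suc i} (s≤s i<n) (s≤s i<xs) = there (at∈take n xs i<n i<xs)

  ≡-by-at : ∀ (xs ys : List ℕ) → length xs ≡ length ys → (∀ i → i < length xs → at xs i ≡ at ys i) → xs ≡ ys
  ≡-by-at []       []       _   _ = refl
  ≡-by-at (x ∷ xs) (y ∷ ys) len h =
    cong₂ _∷_ (h 0 (s≤s z≤n)) (≡-by-at xs ys (suc-injective len) (λ i i< → h (suc i) (s≤s i<)))

  ≤maxList : ∀ xs {x} → x ∈ xs → x ≤ maxList xs
  ≤maxList (y ∷ xs) (here refl) = m≤m⊔n y (maxList xs)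
  ≤maxList (y ∷ xs) (there x∈) = ≤-trans (≤maxList xs x∈) (m≤n⊔m y (maxList xs))

  ≤lastIx⇒<length : ∀ (xs : List ℕ) {i} → xs ≢ [] → i ≤ lastIx xs → i < length xs
  ≤lastIx⇒<length []       ne _   = ⊥-elim (ne refl)
  ≤lastIx⇒<length (x ∷ xs) _  i≤ = s≤s i≤

  0<≤lastIx⇒<length : ∀ (xs : List ℕ) {i} → 0 < i → i ≤ lastIx xs → i < length xs
  0<≤lastIx⇒<length []       0<i i≤ = ⊥-elim (<-irrefl refl (<-≤-trans 0<i i≤))
  0<≤lastIx⇒<length (x ∷ xs) _   i≤ = s≤s i≤

  <length⇒≤lastIx : ∀ (xs : List ℕ) {i} → i < length xs → i ≤ lastIx xs
  <length⇒≤lastIx (x ∷ xs) (s≤s i≤) = i≤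

  <∸⇒+< : ∀ a {i m} → i < m ∸ a → a + i < m
  <∸⇒+< zero    i<           = i<
  <∸⇒+< (suc a) {m = zero} ()
  <∸⇒+< (suc a) {m = suc m} i< = s≤s (<∸⇒+< a i<)

  +<⇒<∸ : ∀ a {i m} → a + i < m → i < m ∸ a
  +<⇒<∸ zero    a+i<         = a+i<
  +<⇒<∸ (suc a) {m = suc m} (s≤s a+i<) = +<⇒<∸ a a+i<

  at-slice : ∀ xs a b {i} → a + i ≤ b → at (slice xs a b) i ≡ at xs (a + i)
  at-slice xs a b {i} a+i≤b = trans (at-take (suc b ∸ a) (drop a xs) (+<⇒<∸ a (s≤s a+i≤b))) (at-drop xs a i)

  length-slice : ∀ xs a b → b < length xs → length (slice xs a b) ≡ suc b ∸ a
  length-slice xs a b b< = begin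
    length (take (suc b ∸ a) (drop a xs))   ≡⟨ length-take (suc b ∸ a) (drop a xs) ⟩
    (suc b ∸ a) ⊓ length (drop a xs)        ≡⟨ cong ((suc b ∸ a) ⊓_) (length-drop a xs) ⟩
    (suc b ∸ a) ⊓ (length xs ∸ a)           ≡⟨ m≤n⇒m⊓n≡m (∸-monoˡ-≤ a b<) ⟩
    suc b ∸ a                               ∎
    where open ≡-Reasoning

  ∈-slice⁻ : ∀ xs a b {x} → x ∈ slice xs a b → Σ ℕ λ j → (a ≤ j) × (j ≤ b) × (at xs j ≡ x)
  ∈-slice⁻ xs a b x∈ with ∈-take⁻ (suc b ∸ a) (drop a xs) x∈
  ... | i , i< , e = a + i , m≤m+n a i , ≤-pred (<∸⇒+< a i<) , trans (sym (at-drop xs a i)) e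

  at∈slice : ∀ xs a b {j} → a ≤ j → j ≤ b → b < length xs → at xs j ∈ slice xs a b
  at∈slice xs a b {j} a≤j j≤b b< =
    subst (_∈ slice xs a b) (trans (at-drop xs a (j ∸ a)) (cong (at xs) a+[j∸a]≡j))
      (at∈take (suc b ∸ a) (drop a xs) (+<⇒<∸ a (subst (_< suc b) (sym a+[j∸a]≡j) (s≤s j≤b)))
        (subst (j ∸ a <_) (sym (length-drop a xs)) (+<⇒<∸ a (subst (_< length xs) (sym a+[j∸a]≡j) (≤-<-trans j≤b b<)))))
    where
    a+[j∸a]≡j : a + (j ∸ a) ≡ j
    a+[j∸a]≡j = m+[n∸m]≡n a≤j

  eraseStep : List ℕ → ℕ → List ℕ
  eraseStep L x = if elem x L then prefixTo x L else L ++ [ x ]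

  eraseStep-in : ∀ L x → elem x L ≡ true → eraseStep L x ≡ prefixTo x L
  eraseStep-in L x e rewrite e = refl

  eraseStep-out : ∀ L x → elem x L ≡ false → eraseStep L x ≡ L ++ [ x ]
  eraseStep-out L x e rewrite e = refl

  prefixTo-here : ∀ x xs → prefixTo x (x ∷ xs) ≡ [ x ]
  prefixTo-here x xs rewrite ≡ᵇ-refl x = refl

  prefixTo-++ : ∀ x xs ys → x ∉ xs → prefixTo x (xs ++ ys) ≡ xs ++ prefixTo x ys
  prefixTo-++ x []       ys _  = refl
  prefixTo-++ x (y ∷ xs) ys x∉ with x ≡ᵇ y in e
  ... | true  = ⊥-elim (x∉ (here (≡ᵇ-true⇒≡ x y e)))
  ... | false = cong (y ∷_) (prefixTo-++ x xs ys (λ x∈ → x∉ (there x∈)))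

  prefixTo-split : ∀ x xs ys → x ∉ xs → prefixTo x (xs ++ x ∷ ys) ≡ xs ++ [ x ]
  prefixTo-split x xs ys x∉ = trans (prefixTo-++ x xs (x ∷ ys) x∉) (cong (xs ++_) (prefixTo-here x ys))

  prefixTo-⊆ : ∀ x xs {y} → y ∈ prefixTo x xs → y ∈ xs
  prefixTo-⊆ x (z ∷ xs) y∈ with x ≡ᵇ z
  prefixTo-⊆ x (z ∷ xs) (here e)  | true  = here e
  prefixTo-⊆ x (z ∷ xs) (here e)  | false = here e
  prefixTo-⊆ x (z ∷ xs) (there y∈) | false = there (prefixTo-⊆ x xs y∈)

  prefixTo-++-⊆ : ∀ x xs ys {y} → x ∈ xs → y ∈ prefixTo x (xs ++ ys) → y ∈ xs
  prefixTo-++-⊆ x (z ∷ xs) ys x∈ y∈ with x ≡ᵇ z in e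
  prefixTo-++-⊆ x (z ∷ xs) ys x∈ (here y≡) | true = here y≡
  prefixTo-++-⊆ x (z ∷ xs) ys (here x≡z) y∈ | false = ⊥-elim (≡ᵇ-false⇒≢ x z e x≡z)
  prefixTo-++-⊆ x (z ∷ xs) ys (there x∈) (here y≡) | false = here y≡
  prefixTo-++-⊆ x (z ∷ xs) ys (there x∈) (there y∈) | false = there (prefixTo-++-⊆ x xs ys x∈ y∈)

  prefixTo-∷ : ∀ x z xs → Σ (List ℕ) λ R → prefixTo x (z ∷ xs) ≡ z ∷ R
  prefixTo-∷ x z xs with x ≡ᵇ z
  ... | true  = [] , refl
  ... | false = prefixTo x xs , refl

  ∈-first-split : ∀ x xs → x ∈ xs → Σ (List ℕ) λ A → Σ (List ℕ) λ B → (xs ≡ A ++ x ∷ B) × (x ∉ A)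
  ∈-first-split x (z ∷ xs) (here refl) = [] , xs , refl , λ ()
  ∈-first-split x (z ∷ xs) (there x∈) with z ≟ℕ x
  ... | yes refl = [] , xs , refl , λ ()
  ... | no z≢x with ∈-first-split x xs x∈
  ...   | A , B , refl , x∉A = z ∷ A , B , refl , λ { (here x≡z) → z≢x (sym x≡z) ; (there x∈A) → x∉A x∈A }

  prefixTo-map : ∀ (g : ℕ → ℕ) x xs → (∀ y → y ∈ xs → g y ≡ g x → y ≡ x) → prefixTo (g x) (map g xs) ≡ map g (prefixTo x xs)
  prefixTo-map g x []       _ = refl
  prefixTo-map g x (y ∷ xs) g-inj with x ≡ᵇ y in e₁ | g x ≡ᵇ g y in e₂
  ... | true  | true  = refl
  ... | false | false = cong (g y ∷_) (prefixTo-map g x xs (λ z z∈ → g-inj z (there z∈)))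
  ... | true  | false = ⊥-elim (≡ᵇ-false⇒≢ _ _ e₂ (cong g (≡ᵇ-true⇒≡ _ _ e₁)))
  ... | false | true  = ⊥-elim (≡ᵇ-false⇒≢ _ _ e₁ (sym (g-inj y (here refl) (sym (≡ᵇ-true⇒≡ _ _ e₂)))))

  ∈-eraseStep⁻ : ∀ L x {y} → y ∈ eraseStep L x → (y ≡ x) ⊎ (y ∈ L)
  ∈-eraseStep⁻ L x y∈ with elem x L
  ... | true  = inj₂ (prefixTo-⊆ x L y∈)
  ... | false with ∈-++⁻ L y∈
  ...   | inj₁ y∈L        = inj₂ y∈L
  ...   | inj₂ (here y≡x) = inj₁ y≡x

  eraseStep-ends : ∀ L x → Σ (List ℕ) λ A → (eraseStep L x ≡ A ++ [ x ]) × (x ∉ A)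
  eraseStep-ends L x with elem x L in e
  ... | false = L , refl , elem-false⇒∉ x L e
  ... | true with ∈-first-split x L (elem⇒∈ x L e)
  ...   | A , B , refl , x∉A = A , prefixTo-split x A B x∉A , x∉A

  eraseStep-∷ : ∀ z L x → Σ (List ℕ) λ R → eraseStep (z ∷ L) x ≡ z ∷ R
  eraseStep-∷ z L x with elem x (z ∷ L)
  ... | true  = prefixTo-∷ x z L
  ... | false = L ++ [ x ] , refl

  eraseStep-++ : ∀ x A L → x ∉ A → eraseStep (A ++ L) x ≡ A ++ eraseStep L x
  eraseStep-++ x A L x∉A rewrite elem-++ʳ x A L x∉A with elem x L
  ... | true  = prefixTo-++ x A L x∉A
  ... | false = ++-assoc A L [ x ]

  eraseStep-above : ∀ A y B x →
    ((x ∈ A) × (∀ z → z ∈ eraseStep (A ++ y ∷ B) x → z ∈ A))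
    ⊎ ((x ∉ A) × (Σ (List ℕ) λ B' → eraseStep (A ++ y ∷ B) x ≡ A ++ y ∷ B'))
  eraseStep-above A y B x with any? (x ≟ℕ_) A
  ... | yes x∈A = inj₁ (x∈A , λ z z∈ → absorbed z∈)
    where
    absorbed : ∀ {z} → z ∈ eraseStep (A ++ y ∷ B) x → z ∈ A
    absorbed z∈ with elem x (A ++ y ∷ B) in e
    ... | true  = prefixTo-++-⊆ x A (y ∷ B) x∈A z∈
    ... | false = ⊥-elim (elem-false⇒∉ x _ e (∈-++⁺ˡ x∈A))
  ... | no x∉A = inj₂ (x∉A , _ , trans (eraseStep-++ x A (y ∷ B) x∉A) (cong (A ++_) (proj₂ (eraseStep-∷ y B x))))

  LEW-ends : ∀ ω k → Σ (List ℕ) λ A → (LEW ω k ≡ A ++ [ at ω k ]) × (at ω k ∉ A)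
  LEW-ends ω zero    = [] , refl , λ ()
  LEW-ends ω (suc k) = eraseStep-ends (LEW ω k) (at ω (suc k))

  at∈LEW : ∀ ω k → at ω k ∈ LEW ω k
  at∈LEW ω k with LEW-ends ω k
  ... | A , e , _ rewrite e = ∈-++⁺ʳ A (here refl)

  ∈LEW⇒occurs : ∀ ω k {y} → y ∈ LEW ω k → Σ ℕ λ i → (i ≤ k) × (at ω i ≡ y)
  ∈LEW⇒occurs ω zero    (here refl) = 0 , z≤n , refl
  ∈LEW⇒occurs ω (suc k) y∈ with ∈-eraseStep⁻ (LEW ω k) (at ω (suc k)) y∈
  ... | inj₁ y≡ = suc k , ≤-refl , sym y≡
  ... | inj₂ y∈LEW = let (i , i≤k , e) = ∈LEW⇒occurs ω k y∈LEW in i , m≤n⇒m≤1+n i≤k , e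

  lastOcc-≤ : ∀ ω x k → lastOcc ω x k ≤ k
  lastOcc-≤ ω x zero    = z≤n
  lastOcc-≤ ω x (suc k) with at ω (suc k) ≡ᵇ x
  ... | true  = ≤-refl
  ... | false = m≤n⇒m≤1+n (lastOcc-≤ ω x k)

  ≤lastOcc : ∀ ω x k {i} → i ≤ k → at ω i ≡ x → i ≤ lastOcc ω x k
  ≤lastOcc ω x zero    i≤k _ = i≤k
  ≤lastOcc ω x (suc k) i≤k e with at ω (suc k) ≡ᵇ x in e'
  ... | true = i≤k
  ... | false with m≤n⇒m<n∨m≡n i≤k
  ...   | inj₁ (s≤s i≤k') = ≤lastOcc ω x k i≤k' e
  ...   | inj₂ refl       = ⊥-elim (≡ᵇ-false⇒≢ _ _ e' e)

  at-lastOcc : ∀ ω x k {i} → i ≤ k → at ω i ≡ x → at ω (lastOcc ω x k) ≡ x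
  at-lastOcc ω x zero    z≤n e = e
  at-lastOcc ω x (suc k) i≤k e with at ω (suc k) ≡ᵇ x in e'
  ... | true = ≡ᵇ-true⇒≡ _ _ e'
  ... | false with m≤n⇒m<n∨m≡n i≤k
  ...   | inj₁ (s≤s i≤k') = at-lastOcc ω x k i≤k' e
  ...   | inj₂ refl       = ⊥-elim (≡ᵇ-false⇒≢ _ _ e' e)

  after-lastOcc : ∀ ω x k {j} → lastOcc ω x k < j → j ≤ k → at ω j ≢ x
  after-lastOcc ω x zero    lt z≤n = λ _ → <-irrefl refl lt
  after-lastOcc ω x (suc k) lt j≤k e with at ω (suc k) ≡ᵇ x in e'
  ... | true = <-irrefl refl (<-≤-trans lt j≤k)
  ... | false with m≤n⇒m<n∨m≡n j≤k
  ...   | inj₁ (s≤s j≤k') = after-lastOcc ω x k lt j≤k' e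
  ...   | inj₂ refl       = ≡ᵇ-false⇒≢ _ _ e' e

  lastOcc-unique : ∀ ω x k {q} → q ≤ k → at ω q ≡ x → (∀ j → q < j → j ≤ k → at ω j ≢ x) → lastOcc ω x k ≡ q
  lastOcc-unique ω x k {q} q≤k e none with m≤n⇒m<n∨m≡n (≤lastOcc ω x k q≤k e)
  ... | inj₂ q≡ = sym q≡
  ... | inj₁ q< = ⊥-elim (none _ q< (lastOcc-≤ ω x k) (at-lastOcc ω x k q≤k e))

  ∈LEW-backwards : ∀ ω x k {t} → x ∈ LEW ω k → (∀ j → t < j → j ≤ k → at ω j ≢ x) → t ≤ k → x ∈ LEW ω t
  ∈LEW-backwards ω x zero    x∈ _    z≤n = x∈
  ∈LEW-backwards ω x (suc k) x∈ none t≤k with m≤n⇒m<n∨m≡n t≤k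
  ... | inj₂ refl = x∈
  ... | inj₁ (s≤s t≤k') with ∈-eraseStep⁻ (LEW ω k) (at ω (suc k)) x∈
  ...   | inj₁ x≡  = ⊥-elim (none (suc k) (s≤s t≤k') ≤-refl (sym x≡))
  ...   | inj₂ x∈' = ∈LEW-backwards ω x k x∈' (λ j t<j j≤k → none j t<j (m≤n⇒m≤1+n j≤k)) t≤k'

  -- The erasure forest

  data Parent (ω : Walk) : ℕ → ℕ → Set where
    parent : ∀ k {q} → elem (at ω (suc k)) (LEW ω k) ≡ true → lastOcc ω (at ω (suc k)) k ≡ q → Parent ω q (suc k)

  Ancestor : Walk → ℕ → ℕ → Set
  Ancestor ω = TransClosure (Parent ω)

  Parent-< : ∀ {ω q j} → Parent ω q j → q < j
  Parent-< {ω} (parent k _ refl) = s≤s (lastOcc-≤ ω _ k)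

  Parent-at : ∀ {ω q j} → Parent ω q j → at ω q ≡ at ω j
  Parent-at {ω} (parent k x∈ refl) with ∈LEW⇒occurs ω k (elem⇒∈ _ _ x∈)
  ... | i , i≤k , e = at-lastOcc ω _ k i≤k e

  Parent-at-most-one-child : ∀ {ω p j₁ j₂} → Parent ω p j₁ → Parent ω p j₂ → ¬ (j₁ < j₂)
  Parent-at-most-one-child {ω} p₁ p₂@(parent k _ refl) j₁<j₂ =
    <-irrefl refl (<-≤-trans (Parent-< p₁) (≤lastOcc ω _ k (≤-pred j₁<j₂) (trans (sym (Parent-at p₁)) (Parent-at p₂))))

  Ancestor-< : ∀ {ω i j} → Ancestor ω i j → i < j
  Ancestor-< [ p ]⁺  = Parent-< p
  Ancestor-< (p ◅ a) = <-trans (Parent-< p) (Ancestor-< a)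

  Ancestor-at : ∀ {ω i j} → Ancestor ω i j → at ω i ≡ at ω j
  Ancestor-at [ p ]⁺  = Parent-at p
  Ancestor-at (p ◅ a) = trans (Parent-at p) (Ancestor-at a)

  Ancestor-viewʳ : ∀ {ω i j} → Ancestor ω i j → Parent ω i j ⊎ Σ ℕ λ m → Ancestor ω i m × Parent ω m j
  Ancestor-viewʳ [ p ]⁺ = inj₁ p
  Ancestor-viewʳ (p ◅ a) with Ancestor-viewʳ a
  ... | inj₁ q           = inj₂ (_ , [ p ]⁺ , q)
  ... | inj₂ (m , b , q) = inj₂ (m , p ◅ b , q)

  Ancestor-first : ∀ {ω i j} → Ancestor ω i j → Σ ℕ λ j₁ → Parent ω i j₁ × (j₁ ≤ j)
  Ancestor-first [ p ]⁺  = _ , p , ≤-refl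
  Ancestor-first (p ◅ a) = _ , p , <⇒≤ (Ancestor-< a)

  Revisits : Walk → ℕ → ℕ → Set
  Revisits ω i j = (at ω i ≡ at ω j) × (∀ t → i ≤ t → t < j → at ω i ∈ LEW ω t)

  Parent-stays : ∀ {ω q j} → Parent ω q j → ∀ t → q ≤ t → t < j → at ω q ∈ LEW ω t
  Parent-stays {ω} p@(parent k x∈ refl) t q≤t (s≤s t≤k) rewrite Parent-at p =
    ∈LEW-backwards ω _ k (elem⇒∈ _ _ x∈) (λ j q<j j≤k → after-lastOcc ω _ k (≤-<-trans q≤t q<j) j≤k) t≤k

  Ancestor⇒Revisits : ∀ {ω i j} → Ancestor ω i j → Revisits ω i j
  Ancestor⇒Revisits [ p ]⁺ = Parent-at p , Parent-stays p
  Ancestor⇒Revisits {ω} {i} {j} (_◅_ {y = m} p a) with Ancestor⇒Revisits a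
  ... | e , stays = trans (Parent-at p) e , stays′
    where
    stays′ : ∀ t → i ≤ t → t < j → at ω i ∈ LEW ω t
    stays′ t i≤t t<j with t <? m
    ... | yes t<m = Parent-stays p t i≤t t<m
    ... | no t≮m rewrite Parent-at p = stays t (≮⇒≥ t≮m) t<j

  Revisits⇒Ancestor : ∀ ω i j → i < j → Revisits ω i j → Ancestor ω i j
  Revisits⇒Ancestor ω i j = go j ≤-refl
    where
    go : ∀ n {j} → j ≤ n → i < j → Revisits ω i j → Ancestor ω i j
    go (suc n) {suc k} (s≤s k≤n) (s≤s i≤k) (e , stays) = extend (m≤n⇒m<n∨m≡n (≤lastOcc ω _ k i≤k e))
      where
      q = lastOcc ω (at ω (suc k)) k
      p : Parent ω q (suc k)
      p = parent k (∈⇒elem _ _ (subst (_∈ LEW ω k) e (stays k i≤k ≤-refl))) refl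
      extend : i < q ⊎ i ≡ q → Ancestor ω i (suc k)
      extend (inj₂ i≡q) = subst (λ z → Ancestor ω z (suc k)) (sym i≡q) [ p ]⁺
      extend (inj₁ i<q) = go n (≤-trans (lastOcc-≤ ω _ k) k≤n) i<q
        (trans e (sym (at-lastOcc ω _ k i≤k e)) , λ t i≤t t<q → stays t i≤t (<-trans t<q (Parent-< p))) ∷ʳ p

  ∈LESupto⇒Ancestor : ∀ ω K {a b} → (a , b) ∈ LESupto ω K → (b ≤ K) × Ancestor ω a b
  ∈LESupto⇒Ancestor ω (suc k) ab∈ with elem (at ω (suc k)) (LEW ω k) in x∈
  ... | false = let (b≤k , anc) = ∈LESupto⇒Ancestor ω k ab∈ in m≤n⇒m≤1+n b≤k , anc
  ... | true with ∈-++⁻ (LESupto ω k) ab∈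
  ...   | inj₁ ab∈′ = let (b≤k , anc) = ∈LESupto⇒Ancestor ω k ab∈′ in m≤n⇒m≤1+n b≤k , anc
  ...   | inj₂ (here refl) = ≤-refl , [ parent k x∈ refl ]⁺
  ...   | inj₂ (there ab∈′) with ∈-map⁻ _ ab∈′
  ...     | (c , d) , cd∈ , refl with bfilter⁻ _ (LESupto ω k) cd∈
  ...       | cd∈′ , d≡ᵇ with ∈LESupto⇒Ancestor ω k cd∈′
  ...         | _ , anc rewrite ≡ᵇ-true⇒≡ d _ d≡ᵇ = ≤-refl , anc ∷ʳ parent k x∈ refl

  Ancestor⇒∈LESupto : ∀ ω K {a b} → b ≤ K → Ancestor ω a b → (a , b) ∈ LESupto ω K
  Ancestor⇒∈LESupto ω zero    z≤n anc with () ← Ancestor-< anc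
  Ancestor⇒∈LESupto ω (suc k) b≤ anc with m≤n⇒m<n∨m≡n b≤
  ... | inj₁ (s≤s b≤k) with elem (at ω (suc k)) (LEW ω k)
  ...   | true  = ∈-++⁺ˡ (Ancestor⇒∈LESupto ω k b≤k anc)
  ...   | false = Ancestor⇒∈LESupto ω k b≤k anc
  Ancestor⇒∈LESupto ω (suc k) b≤ anc | inj₂ refl with Ancestor-viewʳ anc
  ... | inj₁ (parent .k x∈ refl) rewrite x∈ = ∈-++⁺ʳ (LESupto ω k) (here refl)
  ... | inj₂ (m , anc′ , p@(parent .k x∈ refl)) rewrite x∈ =
    ∈-++⁺ʳ (LESupto ω k) (there (∈-map⁺ _ (bfilter⁺ _ (LESupto ω k)
      (Ancestor⇒∈LESupto ω k (≤-pred (Parent-< p)) anc′) (≡ᵇ-refl m))))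

  inLES⇒Ancestor : ∀ ω a b → inLES ω a b ≡ true → (b ≤ lastIx ω) × Ancestor ω a b
  inLES⇒Ancestor ω a b e = ∈LESupto⇒Ancestor ω (lastIx ω) (any-pairEq⇒∈ a b (LES ω) e)

  Ancestor⇒inLES : ∀ ω a b → b ≤ lastIx ω → Ancestor ω a b → inLES ω a b ≡ true
  Ancestor⇒inLES ω a b b≤ anc = ∈⇒any-pairEq a b (LES ω) (Ancestor⇒∈LESupto ω (lastIx ω) b≤ anc)

  newLabel : Walk → ℕ → ℕ
  newLabel u k = if elem (at u (suc k)) (LEW u k)
    then at (cactusUpto u k) (lastOcc u (at u (suc k)) k)
    else suc (maxList (cactusUpto u k))

  label : Walk → ℕ → ℕ
  label u i = at (cactusUpto u i) i

  length-cactusUpto : ∀ u k → length (cactusUpto u k) ≡ suc k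
  length-cactusUpto u zero = refl
  length-cactusUpto u (suc k) rewrite length-++ (cactusUpto u k) {[ newLabel u k ]} | length-cactusUpto u k = +-comm (suc k) 1

  at-cactusUpto : ∀ u k {i} → i ≤ k → at (cactusUpto u k) i ≡ label u i
  at-cactusUpto u zero    z≤n = refl
  at-cactusUpto u (suc k) {i} i≤ with m≤n⇒m<n∨m≡n i≤
  ... | inj₂ refl       = refl
  ... | inj₁ (s≤s i≤k) = trans (at-++ˡ (cactusUpto u k) _ (subst (i <_) (sym (length-cactusUpto u k)) (s≤s i≤k)))
                               (at-cactusUpto u k i≤k)

  label-suc : ∀ u k → label u (suc k) ≡ newLabel u k
  label-suc u k = subst (λ n → at (cactusUpto u k ++ [ newLabel u k ]) n ≡ newLabel u k)
    (length-cactusUpto u k) (at-++-length (cactusUpto u k) (newLabel u k) [])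

  label-revisit : ∀ u k → elem (at u (suc k)) (LEW u k) ≡ true → label u (suc k) ≡ label u (lastOcc u (at u (suc k)) k)
  label-revisit u k x∈ rewrite label-suc u k | x∈ = at-cactusUpto u k (lastOcc-≤ u _ k)

  label-fresh : ∀ u k {i} → i ≤ k → elem (at u (suc k)) (LEW u k) ≡ false → label u i ≢ label u (suc k)
  label-fresh u k {i} i≤k x∉ e = <-irrefl refl (≤-<-trans label≤max (subst (maxList (cactusUpto u k) <_) (sym e) max<new))
    where
    label≤max : label u i ≤ maxList (cactusUpto u k)
    label≤max = subst (_≤ maxList (cactusUpto u k)) (at-cactusUpto u k i≤k)
      (≤maxList _ (at∈ (cactusUpto u k) (subst (i <_) (sym (length-cactusUpto u k)) (s≤s i≤k))))
    max<new : maxList (cactusUpto u k) < label u (suc k)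
    max<new rewrite label-suc u k | x∉ = ≤-refl

  Parent-label : ∀ {u q j} → Parent u q j → label u q ≡ label u j
  Parent-label {u} (parent k x∈ refl) = sym (label-revisit u k x∈)

  Ancestor-label : ∀ {u i j} → Ancestor u i j → label u i ≡ label u j
  Ancestor-label [ p ]⁺  = Parent-label p
  Ancestor-label (p ◅ a) = trans (Parent-label p) (Ancestor-label a)

  label≡⇒Ancestor : ∀ u {i j} → i < j → label u i ≡ label u j → Ancestor u i j
  label≡⇒Ancestor u {j = j} = go j ≤-refl
    where
    go : ∀ n {i j} → j ≤ n → i < j → label u i ≡ label u j → Ancestor u i j
    go (suc n) {i} {suc k} (s≤s k≤n) (s≤s i≤k) e with true-or-false (elem (at u (suc k)) (LEW u k))
    ... | inj₂ x∉ = ⊥-elim (label-fresh u k i≤k x∉ e)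
    ... | inj₁ x∈ with <-cmp i (lastOcc u (at u (suc k)) k)
    ...   | tri≈ _ refl _ = [ parent k x∈ refl ]⁺
    ...   | tri< i<q _ _ = go n (≤-trans (lastOcc-≤ u _ k) k≤n) i<q (trans e (label-revisit u k x∈)) ∷ʳ parent k x∈ refl
    ...   | tri> _ _ q<i with Ancestor-first (go n (≤-trans i≤k k≤n) q<i (sym (trans e (label-revisit u k x∈))))
    ...     | j₁ , p₁ , j₁≤i = ⊥-elim (Parent-at-most-one-child p₁ (parent k x∈ refl) (≤-<-trans j₁≤i (s≤s i≤k)))

  lastIx-C : ∀ u → lastIx (C u) ≡ lastIx u
  lastIx-C u = cong (_∸ 1) (length-cactusUpto u (lastIx u))

  length-C : ∀ u → u ≢ [] → length (C u) ≡ length u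
  length-C []      u≢[] = ⊥-elim (u≢[] refl)
  length-C (x ∷ u) _    = length-cactusUpto (x ∷ u) (length u)

  at-C : ∀ u {i} → i ≤ lastIx u → at (C u) i ≡ label u i
  at-C u = at-cactusUpto u (lastIx u)

  C≢[] : ∀ u → C u ≢ []
  C≢[] u e with () ← trans (sym (length-cactusUpto u (lastIx u))) (cong length e)

  <length-C⇒≤lastIx : ∀ u {i} → i < length (C u) → i ≤ lastIx u
  <length-C⇒≤lastIx u {i} i< = ≤-pred (subst (i <_) (length-cactusUpto u (lastIx u)) i<)

  label≡⇔Ancestor : ∀ u {i j} → i < j → j ≤ lastIx u → (at (C u) i ≡ at (C u) j → Ancestor u i j) × (Ancestor u i j → at (C u) i ≡ at (C u) j)
  label≡⇔Ancestor u i<j j≤ =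
    (λ e → label≡⇒Ancestor u i<j (trans (sym (at-C u i≤)) (trans e (at-C u j≤)))) ,
    (λ anc → trans (at-C u i≤) (trans (Ancestor-label anc) (sym (at-C u j≤))))
    where i≤ = ≤-trans (<⇒≤ i<j) j≤

  stackLabel : Walk → ℕ → ℕ → ℕ
  stackLabel u k y = label u (lastOcc u y k)

  stackLabel-injective : ∀ u k {x y} → x ∈ LEW u k → y ∈ LEW u k → stackLabel u k y ≡ stackLabel u k x → y ≡ x
  stackLabel-injective u k {x} {y} x∈ y∈ e with ∈LEW⇒occurs u k x∈ | ∈LEW⇒occurs u k y∈
  ... | ix , ix≤k , ex | iy , iy≤k , ey with at-lastOcc u x k ix≤k ex | at-lastOcc u y k iy≤k ey
  ...   | ax | ay with <-cmp (lastOcc u y k) (lastOcc u x k)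
  ...     | tri< lt _ _ = trans (sym ay) (trans (Ancestor-at (label≡⇒Ancestor u lt e)) ax)
  ...     | tri≈ _ q _  = trans (sym ay) (trans (cong (at u) q) ax)
  ...     | tri> _ _ gt = trans (sym ay) (trans (sym (Ancestor-at (label≡⇒Ancestor u gt (sym e)))) ax)

  stackLabel-suc : ∀ u k {y} → y ≢ at u (suc k) → stackLabel u (suc k) y ≡ stackLabel u k y
  stackLabel-suc u k {y} y≢ with at u (suc k) ≡ᵇ y in e
  ... | true  = ⊥-elim (y≢ (sym (≡ᵇ-true⇒≡ _ _ e)))
  ... | false = refl

  stackLabel-new : ∀ u k → stackLabel u (suc k) (at u (suc k)) ≡ label u (suc k)
  stackLabel-new u k rewrite ≡ᵇ-refl (at u (suc k)) = refl

  module _ (u : Walk) (k : ℕ) (sk≤ : suc k ≤ lastIx u) (ih : LEW (C u) k ≡ map (stackLabel u k) (LEW u k)) where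

    private
      x = at u (suc k)
      L = LEW u k
      at-C-suc : at (C u) (suc k) ≡ label u (suc k)
      at-C-suc = at-C u sk≤

    elem-LEW-C-step : elem (at (C u) (suc k)) (LEW (C u) k) ≡ elem x L
    elem-LEW-C-step rewrite ih | at-C-suc with true-or-false (elem x L)
    ... | inj₁ x∈ = trans (∈⇒elem (label u (suc k)) (map (stackLabel u k) L)
                            (subst (_∈ map (stackLabel u k) L) (sym (label-revisit u k x∈)) (∈-map⁺ (stackLabel u k) (elem⇒∈ x L x∈))))
                          (sym x∈)
    ... | inj₂ x∉ = trans (∉⇒elem-false (label u (suc k)) (map (stackLabel u k) L) λ c∈ →
                            let (y , _ , c≡) = ∈-map⁻ (stackLabel u k) c∈ in label-fresh u k (lastOcc-≤ u y k) x∉ (sym c≡))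
                          (sym x∉)

    LEW-C-step : LEW (C u) (suc k) ≡ map (stackLabel u (suc k)) (LEW u (suc k))
    LEW-C-step with true-or-false (elem x L)
    ... | inj₁ x∈ = begin
      eraseStep (LEW (C u) k) (at (C u) (suc k))       ≡⟨ eraseStep-in (LEW (C u) k) (at (C u) (suc k)) (trans elem-LEW-C-step x∈) ⟩
      prefixTo (at (C u) (suc k)) (LEW (C u) k)        ≡⟨ cong₂ prefixTo (trans at-C-suc (label-revisit u k x∈)) ih ⟩
      prefixTo (stackLabel u k x) (map (stackLabel u k) L)
        ≡⟨ prefixTo-map (stackLabel u k) x L (λ y y∈ → stackLabel-injective u k (elem⇒∈ x L x∈) y∈) ⟩
      map (stackLabel u k) (prefixTo x L)              ≡⟨ map-cong-local (All.tabulate agree) ⟩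
      map (stackLabel u (suc k)) (prefixTo x L)        ≡⟨ cong (map (stackLabel u (suc k))) (sym (eraseStep-in L x x∈)) ⟩
      map (stackLabel u (suc k)) (eraseStep L x)       ∎
      where
      open ≡-Reasoning
      agree : ∀ {y} → y ∈ prefixTo x L → stackLabel u k y ≡ stackLabel u (suc k) y
      agree {y} _ with y ≟ℕ x
      ... | yes refl = trans (sym (label-revisit u k x∈)) (sym (stackLabel-new u k))
      ... | no y≢x   = sym (stackLabel-suc u k y≢x)
    ... | inj₂ x∉ = begin
      eraseStep (LEW (C u) k) (at (C u) (suc k))       ≡⟨ eraseStep-out (LEW (C u) k) (at (C u) (suc k)) (trans elem-LEW-C-step x∉) ⟩
      LEW (C u) k ++ [ at (C u) (suc k) ]              ≡⟨ cong₂ (λ a b → a ++ [ b ]) ih (trans at-C-suc (sym (stackLabel-new u k))) ⟩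
      map (stackLabel u k) L ++ [ stackLabel u (suc k) x ]
        ≡⟨ cong (_++ [ stackLabel u (suc k) x ]) (map-cong-local (All.tabulate agree)) ⟩
      map (stackLabel u (suc k)) L ++ [ stackLabel u (suc k) x ] ≡⟨ sym (map-++ (stackLabel u (suc k)) L [ x ]) ⟩
      map (stackLabel u (suc k)) (L ++ [ x ])          ≡⟨ cong (map (stackLabel u (suc k))) (sym (eraseStep-out L x x∉)) ⟩
      map (stackLabel u (suc k)) (eraseStep L x)       ∎
      where
      open ≡-Reasoning
      agree : ∀ {y} → y ∈ L → stackLabel u k y ≡ stackLabel u (suc k) y
      agree y∈ = sym (stackLabel-suc u k (λ y≡x → elem-false⇒∉ x L x∉ (subst (_∈ L) y≡x y∈)))

  LEW-C : ∀ u k → k ≤ lastIx u → LEW (C u) k ≡ map (stackLabel u k) (LEW u k)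
  LEW-C u zero    _   = cong [_] (at-C u z≤n)
  LEW-C u (suc k) sk≤ = LEW-C-step u k sk≤ (LEW-C u k (≤-trans (n≤1+n k) sk≤))

  elem-LEW-C : ∀ u k → suc k ≤ lastIx u → elem (at (C u) (suc k)) (LEW (C u) k) ≡ elem (at u (suc k)) (LEW u k)
  elem-LEW-C u k sk≤ = elem-LEW-C-step u k sk≤ (LEW-C u k (≤-trans (n≤1+n k) sk≤))

  lastOcc-C : ∀ u k → suc k ≤ lastIx u → elem (at u (suc k)) (LEW u k) ≡ true →
    lastOcc (C u) (at (C u) (suc k)) k ≡ lastOcc u (at u (suc k)) k
  lastOcc-C u k sk≤ x∈ = subst (λ z → lastOcc (C u) z k ≡ q) (sym (trans (at-C u sk≤) (label-revisit u k x∈)))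
    (lastOcc-unique (C u) (label u q) k (lastOcc-≤ u _ k) (at-C u (≤lastIx (lastOcc-≤ u _ k))) none)
    where
    q = lastOcc u (at u (suc k)) k
    ≤lastIx : ∀ {j} → j ≤ k → j ≤ lastIx u
    ≤lastIx j≤k = ≤-trans j≤k (≤-trans (n≤1+n k) sk≤)
    none : ∀ j → q < j → j ≤ k → at (C u) j ≢ label u q
    none j q<j j≤k e = after-lastOcc u _ k q<j j≤k (trans (sym (Ancestor-at q-anc-j)) (Parent-at (parent k x∈ refl)))
      where
      q-anc-j : Ancestor u q j
      q-anc-j = label≡⇒Ancestor u q<j (sym (trans (sym (at-C u (≤lastIx j≤k))) e))

  LESupto-C : ∀ u k → k ≤ lastIx u → LESupto (C u) k ≡ LESupto u k
  LESupto-C u zero    _ = refl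
  LESupto-C u (suc k) sk≤ rewrite elem-LEW-C u k sk≤ | LESupto-C u k (≤-trans (n≤1+n k) sk≤)
    with true-or-false (elem (at u (suc k)) (LEW u k))
  ... | inj₁ x∈ rewrite x∈ | lastOcc-C u k sk≤ x∈ = refl
  ... | inj₂ x∉ rewrite x∉ = refl

  LES-C : ∀ u → LES (C u) ≡ LES u
  LES-C u rewrite lastIx-C u = LESupto-C u (lastIx u) ≤-refl

  inLES-C : ∀ u a b → inLES (C u) a b ≡ inLES u a b
  inLES-C u a b = cong (any (pairEq (a , b))) (LES-C u)

  C-cactus : ∀ u → IsCactus (C u)
  C-cactus u = C≢[] u , λ k k' k<k' k'≤ →
    let k'≤u = subst (k' ≤_) (lastIx-C u) k'≤
        (≡⇒anc , anc⇒≡) = label≡⇔Ancestor u k<k' k'≤u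
    in mk⇔ (λ e → trans (inLES-C u k k') (Ancestor⇒inLES u k k' k'≤u (≡⇒anc e)))
           (λ e → anc⇒≡ (proj₂ (inLES⇒Ancestor u k k' (trans (sym (inLES-C u k k')) e))))

  -- The stack discipline of loop erasure

  stackBelow : Walk → ℕ → List ℕ
  stackBelow ω k = proj₁ (LEW-ends ω k)

  LEW≡stackBelow++ : ∀ ω k → LEW ω k ≡ stackBelow ω k ++ [ at ω k ]
  LEW≡stackBelow++ ω k = proj₁ (proj₂ (LEW-ends ω k))

  at∉stackBelow : ∀ ω k → at ω k ∉ stackBelow ω k
  at∉stackBelow ω k = proj₂ (proj₂ (LEW-ends ω k))

  StaysOn : Walk → ℕ → ℕ → Set
  StaysOn ω k t = ∀ τ → k ≤ τ → τ ≤ t → at ω k ∈ LEW ω τ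

  StaysOn-≤ : ∀ {ω k t t'} → StaysOn ω k t → t' ≤ t → StaysOn ω k t'
  StaysOn-≤ stays t'≤t τ k≤τ τ≤t' = stays τ k≤τ (≤-trans τ≤t' t'≤t)

  StaysOn-suc : ∀ {ω k t} → StaysOn ω k t → at ω k ∈ LEW ω (suc t) → StaysOn ω k (suc t)
  StaysOn-suc stays k∈ τ k≤τ τ≤t+1 with m≤n⇒m<n∨m≡n τ≤t+1
  ... | inj₁ (s≤s τ≤t) = stays τ k≤τ τ≤t
  ... | inj₂ refl      = k∈

  Ancestor-stays : ∀ {ω k k'} → Ancestor ω k k' → StaysOn ω k k'
  Ancestor-stays {ω} {k} anc τ k≤τ τ≤k' with m≤n⇒m<n∨m≡n τ≤k'
  ... | inj₁ τ<k' = proj₂ (Ancestor⇒Revisits anc) τ k≤τ τ<k'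
  ... | inj₂ refl = subst (_∈ LEW ω τ) (sym (Ancestor-at anc)) (at∈LEW ω τ)

  LEW-above : ∀ ω k t → k ≤ t → StaysOn ω k t → Σ (List ℕ) λ B → LEW ω t ≡ stackBelow ω k ++ at ω k ∷ B
  LEW-above ω k zero    z≤n _ = [] , LEW≡stackBelow++ ω zero
  LEW-above ω k (suc t) k≤ stays with m≤n⇒m<n∨m≡n k≤
  ... | inj₂ refl = [] , LEW≡stackBelow++ ω k
  ... | inj₁ (s≤s k≤t) with LEW-above ω k t k≤t (StaysOn-≤ stays (n≤1+n t))
  ...   | B , e with eraseStep-above (stackBelow ω k) (at ω k) B (at ω (suc t))
  ...     | inj₂ (_ , B' , e') = B' , trans (cong (λ L → eraseStep L (at ω (suc t))) e) e'
  ...     | inj₁ (_ , ⊆below) = ⊥-elim (at∉stackBelow ω k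
              (⊆below _ (subst (at ω k ∈_) (cong (λ L → eraseStep L (at ω (suc t))) e) (stays (suc t) k≤ ≤-refl))))

  stackBelow-pops : ∀ ω k t → k ≤ t → StaysOn ω k t → at ω (suc t) ∈ stackBelow ω k → at ω k ∉ LEW ω (suc t)
  stackBelow-pops ω k t k≤t stays x∈below k∈ with LEW-above ω k t k≤t stays
  ... | B , e with eraseStep-above (stackBelow ω k) (at ω k) B (at ω (suc t))
  ...   | inj₁ (_ , ⊆below) = at∉stackBelow ω k (⊆below _ (subst (at ω k ∈_) (cong (λ L → eraseStep L (at ω (suc t))) e) k∈))
  ...   | inj₂ (x∉below , _) = x∉below x∈below

  stackBelow-keeps : ∀ ω k t → k ≤ t → StaysOn ω k t → at ω (suc t) ∉ stackBelow ω k → at ω k ∈ LEW ω (suc t)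
  stackBelow-keeps ω k t k≤t stays x∉below with LEW-above ω k t k≤t stays
  ... | B , e with eraseStep-above (stackBelow ω k) (at ω k) B (at ω (suc t))
  ...   | inj₁ (x∈below , _) = ⊥-elim (x∉below x∈below)
  ...   | inj₂ (_ , B' , e') =
    subst (at ω k ∈_) (sym (trans (cong (λ L → eraseStep L (at ω (suc t))) e) e')) (∈-++⁺ʳ (stackBelow ω k) (here refl))

  stackBelow-not-revisited : ∀ ω k t → StaysOn ω k t → ∀ s → k < s → s ≤ t → at ω s ∉ stackBelow ω k
  stackBelow-not-revisited ω k t stays (suc s) (s≤s k≤s) s+1≤t x∈below =
    stackBelow-pops ω k s k≤s (StaysOn-≤ stays (≤-trans (n≤1+n s) s+1≤t)) x∈below (stays (suc s) (m≤n⇒m≤1+n k≤s) s+1≤t)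

  module _ {ω : Walk} {k k' l l' : ℕ} (k-anc-k' : Ancestor ω k k') (l-anc-l' : Ancestor ω l l') (l≤k : l ≤ k)
    (minimal : ∀ {s t} → Ancestor ω s t → l ≤ s → s ≤ k → k' < t → t < l' → ⊥) where

    -- A step popping below w_k would close a loop (s , t+1) strictly inside (l , l') containing (k , k').
    stays-in-minimal-loop : ∀ {t} → k ≤ t → k' < suc t → suc t < l' → StaysOn ω k t → at ω k ∈ LEW ω (suc t)
    stays-in-minimal-loop {t} k≤t k'<t+1 t+1<l' stays with any? (at ω (suc t) ≟ℕ_) (stackBelow ω k)
    ... | no x∉below  = stackBelow-keeps ω k t k≤t stays x∉below
    ... | yes x∈below = ⊥-elim (minimal [ p ]⁺ l≤s s≤k k'<t+1 t+1<l')
      where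
      x = at ω (suc t)
      s = lastOcc ω x t
      p : Parent ω s (suc t)
      p = parent t (∈⇒elem x _ (subst (x ∈_) (sym (proj₂ (LEW-above ω k t k≤t stays))) (∈-++⁺ˡ x∈below))) refl
      s≤k : s ≤ k
      s≤k with s ≤? k
      ... | yes s≤k = s≤k
      ... | no s≰k  = ⊥-elim (stackBelow-not-revisited ω k t stays s (≰⇒> s≰k) (lastOcc-≤ ω x t)
                                (subst (_∈ stackBelow ω k) (sym (Parent-at p)) x∈below))
      l≤t : l ≤ t
      l≤t = ≤-trans l≤k k≤t
      l≤s : l ≤ s
      l≤s with l ≤? s
      ... | yes l≤s = l≤s
      ... | no l≰s  = ⊥-elim (stackBelow-pops ω l t l≤t (StaysOn-≤ (Ancestor-stays l-anc-l') (≤-trans (n≤1+n t) (<⇒≤ t+1<l')))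
                        x∈below-l (Ancestor-stays l-anc-l' (suc t) (m≤n⇒m≤1+n l≤t) (<⇒≤ t+1<l')))
        where
        x∈LEW-l : x ∈ LEW ω l
        x∈LEW-l = subst (_∈ LEW ω l) (Parent-at p) (Parent-stays p l (<⇒≤ (≰⇒> l≰s)) (s≤s l≤t))
        x∈below-l : x ∈ stackBelow ω l
        x∈below-l with ∈-++⁻ (stackBelow ω l) (subst (x ∈_) (LEW≡stackBelow++ ω l) x∈LEW-l)
        ... | inj₁ x∈ = x∈
        ... | inj₂ (here x≡) = ⊥-elim (l≰s (≤lastOcc ω x t l≤t (sym x≡)))

    revisit-in-minimal-loop⇒Ancestor : ∀ {j} → k' < j → j ≤ l' → at ω j ≡ at ω k → Ancestor ω k j
    revisit-in-minimal-loop⇒Ancestor {j} k'<j j≤l' e =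
      Revisits⇒Ancestor ω k j (<-trans (Ancestor-< k-anc-k') k'<j) (sym e , λ t k≤t t<j → stays t k≤t t<j t k≤t ≤-refl)
      where
      stays : ∀ t → k ≤ t → t < j → StaysOn ω k t
      stays t k≤t t<j with t ≤? k'
      stays t       _    _    | yes t≤k'  = StaysOn-≤ (Ancestor-stays k-anc-k') t≤k'
      stays zero    _    _    | no 0≰k'   = ⊥-elim (0≰k' z≤n)
      stays (suc t) _    t+1<j | no t+1≰k' = StaysOn-suc (stays t k≤t (<-trans (n<1+n t) t+1<j))
        (stays-in-minimal-loop k≤t (≰⇒> t+1≰k') (<-≤-trans t+1<j j≤l') (stays t k≤t (<-trans (n<1+n t) t+1<j)))
        where
        k≤t : k ≤ t
        k≤t = ≤-pred (<-trans (Ancestor-< k-anc-k') (≰⇒> t+1≰k'))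

  -- Admissible cuts of C(ω)

  containing : List Pair → ℕ → ℕ → List Pair
  containing L k k' = bfilter (λ p → (proj₁ p ≤ᵇ k) ∧ (k' <ᵇ proj₂ p)) L

  isMinimal : List Pair → ℕ → ℕ → Pair → Bool
  isMinimal L k k' p = not (any (λ q → not (pairEq q p) ∧ (proj₁ p ≤ᵇ proj₁ q) ∧ (proj₂ q ≤ᵇ proj₂ p)) (containing L k k'))

  revisitsIn : Walk → ℕ → ℕ → ℕ → Bool
  revisitsIn ω k k' l' = elem (at ω k) (slice ω (suc k') l')

  admissibleWith : List Pair → ℕ → (ℕ → ℕ → ℕ → Bool) → Pair → Bool
  admissibleWith L n revisits (k , k') = any (pairEq (k , k')) L ∧ not ((k ≡ᵇ 0) ∧ (k' ≡ᵇ n))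
    ∧ all (λ p → if isMinimal L k k' p then not (revisits k k' (proj₂ p)) else true) (containing L k k')

  admissible≡admissibleWith : ∀ ω p → admissible ω p ≡ admissibleWith (LES ω) (lastIx ω) (revisitsIn ω) p
  admissible≡admissibleWith ω (k , k') = refl

  admissibleWith-cong : ∀ L n r₁ r₂ k k' →
    (any (pairEq (k , k')) L ≡ true → ∀ p → p ∈ containing L k k' → isMinimal L k k' p ≡ true → r₁ k k' (proj₂ p) ≡ r₂ k k' (proj₂ p)) →
    admissibleWith L n r₁ (k , k') ≡ admissibleWith L n r₂ (k , k')
  admissibleWith-cong L n r₁ r₂ k k' h with any (pairEq (k , k')) L in kk'∈
  ... | false = refl
  ... | true  = cong (not ((k ≡ᵇ 0) ∧ (k' ≡ᵇ n)) ∧_) (all-cong _ _ (containing L k k') agree)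
    where
    agree : ∀ p → p ∈ containing L k k' →
      (if isMinimal L k k' p then not (r₁ k k' (proj₂ p)) else true) ≡ (if isMinimal L k k' p then not (r₂ k k' (proj₂ p)) else true)
    agree p p∈ with isMinimal L k k' p in min
    ... | true  = cong not (h refl p p∈ min)
    ... | false = refl

  containing⁻ : ∀ L {k k' l l'} → (l , l') ∈ containing L k k' → ((l , l') ∈ L) × (l ≤ k) × (k' < l')
  containing⁻ L {k} {k'} {l} {l'} ll'∈ with bfilter⁻ _ L ll'∈
  ... | ll'∈L , e with ∧-true⁻ {l ≤ᵇ k} e
  ...   | l≤ᵇk , k'<ᵇl' = ll'∈L , ≤ᵇ-true⇒≤ l k l≤ᵇk , <ᵇ-true⇒< k' l' k'<ᵇl'

  containing⁺ : ∀ L {k k' s t} → (s , t) ∈ L → s ≤ k → k' < t → (s , t) ∈ containing L k k'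
  containing⁺ L st∈ s≤k k'<t = bfilter⁺ _ L st∈ (cong₂ _∧_ (≤⇒≤ᵇ-true s≤k) (<⇒<ᵇ-true k'<t))

  isMinimal⇒no-inner-loop : ∀ ω {k k' l l'} → l' ≤ lastIx ω → isMinimal (LES ω) k k' (l , l') ≡ true →
    ∀ {s t} → Ancestor ω s t → l ≤ s → s ≤ k → k' < t → t < l' → ⊥
  isMinimal⇒no-inner-loop ω {k} {k'} {l} {l'} l'≤ min {s} {t} anc l≤s s≤k k'<t t<l' =
    false≢true (trans (sym (not-true⇒false min)) (any⁺ _ (containing (LES ω) k k') st∈ inner))
    where
    st∈ : (s , t) ∈ containing (LES ω) k k'
    st∈ = containing⁺ (LES ω) (Ancestor⇒∈LESupto ω (lastIx ω) (≤-trans (<⇒≤ t<l') l'≤) anc) s≤k k'<t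
    inner : (not (pairEq (s , t) (l , l')) ∧ (l ≤ᵇ s) ∧ (t ≤ᵇ l')) ≡ true
    inner rewrite ≢⇒≡ᵇ-false t l' (<⇒≢ t<l') | ∧-zeroʳ (s ≡ᵇ l) | ≤⇒≤ᵇ-true l≤s | ≤⇒≤ᵇ-true (<⇒≤ t<l') = refl

  revisitsIn-C : ∀ ω {k k' l l'} → inLES ω k k' ≡ true → (l , l') ∈ containing (LES ω) k k' →
    isMinimal (LES ω) k k' (l , l') ≡ true → revisitsIn (C ω) k k' l' ≡ revisitsIn ω k k' l'
  revisitsIn-C ω {k} {k'} {l} {l'} kk'∈ ll'∈ min = true⇔true⇒≡ C⇒ω ω⇒C
    where
    ll'∈LES = proj₁ (containing⁻ (LES ω) ll'∈)
    l≤k = proj₁ (proj₂ (containing⁻ (LES ω) ll'∈))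
    k'<l' = proj₂ (proj₂ (containing⁻ (LES ω) ll'∈))
    l'≤ = proj₁ (∈LESupto⇒Ancestor ω (lastIx ω) ll'∈LES)
    l-anc-l' = proj₂ (∈LESupto⇒Ancestor ω (lastIx ω) ll'∈LES)
    k-anc-k' = proj₂ (inLES⇒Ancestor ω k k' kk'∈)
    0<l' = ≤-<-trans z≤n k'<l'
    k<j : ∀ {j} → suc k' ≤ j → k < j
    k<j k'<j = <-≤-trans (Ancestor-< k-anc-k') (≤-trans (n≤1+n k') k'<j)
    C⇒ω : revisitsIn (C ω) k k' l' ≡ true → revisitsIn ω k k' l' ≡ true
    C⇒ω e with ∈-slice⁻ (C ω) (suc k') l' (elem⇒∈ _ _ e)
    ... | j , k'<j , j≤l' , e' = ∈⇒elem _ _ (subst (_∈ slice ω (suc k') l') (sym (Ancestor-at k-anc-j))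
                                   (at∈slice ω (suc k') l' k'<j j≤l' (0<≤lastIx⇒<length ω 0<l' l'≤)))
      where
      k-anc-j = proj₁ (label≡⇔Ancestor ω (k<j k'<j) (≤-trans j≤l' l'≤)) (sym e')
    ω⇒C : revisitsIn ω k k' l' ≡ true → revisitsIn (C ω) k k' l' ≡ true
    ω⇒C e with ∈-slice⁻ ω (suc k') l' (elem⇒∈ _ _ e)
    ... | j , k'<j , j≤l' , e' = ∈⇒elem _ _ (subst (_∈ slice (C ω) (suc k') l') Cj≡Ck
                                   (at∈slice (C ω) (suc k') l' k'<j j≤l' (0<≤lastIx⇒<length (C ω) 0<l' (subst (l' ≤_) (sym (lastIx-C ω)) l'≤))))
      where
      k-anc-j = revisit-in-minimal-loop⇒Ancestor k-anc-k' l-anc-l' l≤k (isMinimal⇒no-inner-loop ω l'≤ min) k'<j j≤l' e'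
      Cj≡Ck = sym (proj₂ (label≡⇔Ancestor ω (k<j k'<j) (≤-trans j≤l' l'≤)) k-anc-j)

  admissible-C : ∀ ω p → admissible (C ω) p ≡ admissible ω p
  admissible-C ω (k , k') = begin
    admissible (C ω) (k , k')
      ≡⟨ admissible≡admissibleWith (C ω) (k , k') ⟩
    admissibleWith (LES (C ω)) (lastIx (C ω)) (revisitsIn (C ω)) (k , k')
      ≡⟨ cong₂ (λ L n → admissibleWith L n (revisitsIn (C ω)) (k , k')) (LES-C ω) (lastIx-C ω) ⟩
    admissibleWith (LES ω) (lastIx ω) (revisitsIn (C ω)) (k , k')
      ≡⟨ admissibleWith-cong (LES ω) (lastIx ω) (revisitsIn (C ω)) (revisitsIn ω) k k' (λ kk'∈ _ ll'∈ min → revisitsIn-C ω kk'∈ ll'∈ min) ⟩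
    admissibleWith (LES ω) (lastIx ω) (revisitsIn ω) (k , k')
      ≡⟨ admissible≡admissibleWith ω (k , k') ⟨
    admissible ω (k , k') ∎
    where open ≡-Reasoning

  EAdC-C : ∀ ω → EAdC (C ω) ≡ EAdC ω
  EAdC-C ω = cong (λ L → bfilter (λ c → not (null c)) (chains (length L) (λ _ → true) L)) AdC-C
    where
    AdC-C : AdC (C ω) ≡ AdC ω
    AdC-C rewrite lastIx-C ω = bfilter-cong _ _ (allPairs (lastIx ω)) (admissible-C ω)

  -- Pieces of cuts

  LEW-loop : ∀ {ω k k'} → Ancestor ω k k' → LEW ω k' ≡ LEW ω k
  LEW-loop {ω} {k} {zero}  anc = ⊥-elim (n≮0 (Ancestor-< anc))
  LEW-loop {ω} {k} {suc t} anc with LEW-above ω k t (≤-pred (Ancestor-< anc)) (StaysOn-≤ (Ancestor-stays anc) (n≤1+n t))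
  ... | B , e = begin
    eraseStep (LEW ω t) (at ω (suc t))                 ≡⟨ eraseStep-in (LEW ω t) (at ω (suc t)) (∈⇒elem _ _ x∈) ⟩
    prefixTo (at ω (suc t)) (LEW ω t)                  ≡⟨ cong₂ prefixTo (sym (Ancestor-at anc)) e ⟩
    prefixTo (at ω k) (stackBelow ω k ++ at ω k ∷ B)   ≡⟨ prefixTo-split _ _ B (at∉stackBelow ω k) ⟩
    stackBelow ω k ++ [ at ω k ]                       ≡⟨ sym (LEW≡stackBelow++ ω k) ⟩
    LEW ω k                                            ∎
    where
    open ≡-Reasoning
    x∈ : at ω (suc t) ∈ LEW ω t
    x∈ = subst (_∈ LEW ω t) (Ancestor-at anc) (subst (at ω k ∈_) (sym e) (∈-++⁺ʳ (stackBelow ω k) (here refl)))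

  Ancestor-keeps-LEW : ∀ {ω k k'} → Ancestor ω k k' → ∀ {y} → y ∈ LEW ω k → ∀ t → k ≤ t → t ≤ k' → y ∈ LEW ω t
  Ancestor-keeps-LEW {ω} {k} anc y∈ t k≤t t≤k' with LEW-above ω k t k≤t (StaysOn-≤ (Ancestor-stays anc) t≤k')
  ... | B , e with ∈-++⁻ (stackBelow ω k) (subst (_ ∈_) (LEW≡stackBelow++ ω k) y∈)
  ...   | inj₁ y∈below     = subst (_ ∈_) (sym e) (∈-++⁺ˡ y∈below)
  ...   | inj₂ (here refl) = subst (_ ∈_) (sym e) (∈-++⁺ʳ (stackBelow ω k) (here refl))

  -- u visits ω at positions φ 0 < φ 1 < ⋯, each step of u being a step of ω or jumping over a loop of ω.
  module LoopSkipping (ω u : Walk) (φ : ℕ → ℕ) (φ0≡0 : φ 0 ≡ 0)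
    (at-u : ∀ a → a ≤ lastIx u → at u a ≡ at ω (φ a))
    (φ-step : ∀ a → suc a ≤ lastIx u → (φ (suc a) ≡ suc (φ a)) ⊎ (Σ ℕ λ k' → (φ (suc a) ≡ suc k') × Ancestor ω (φ a) k')) where

    φ-suc-< : ∀ a → suc a ≤ lastIx u → φ a < φ (suc a)
    φ-suc-< a a+1≤ with φ-step a a+1≤
    ... | inj₁ e              = subst (φ a <_) (sym e) ≤-refl
    ... | inj₂ (k' , e , anc) = subst (φ a <_) (sym e) (m≤n⇒m≤1+n (Ancestor-< anc))

    φ-mono-< : ∀ {a b} → a < b → b ≤ lastIx u → φ a < φ b
    φ-mono-< {a} {suc b} (s≤s a≤b) b+1≤ with m≤n⇒m<n∨m≡n a≤b
    ... | inj₁ a<b  = <-trans (φ-mono-< a<b (≤-trans (n≤1+n b) b+1≤)) (φ-suc-< b b+1≤)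
    ... | inj₂ refl = φ-suc-< a b+1≤

    φ-mono-≤ : ∀ {a b} → a ≤ b → b ≤ lastIx u → φ a ≤ φ b
    φ-mono-≤ a≤b b≤ with m≤n⇒m<n∨m≡n a≤b
    ... | inj₁ a<b  = <⇒≤ (φ-mono-< a<b b≤)
    ... | inj₂ refl = ≤-refl

    LEW-u : ∀ a → a ≤ lastIx u → LEW u a ≡ LEW ω (φ a)
    LEW-u zero    _    = trans (cong [_] (trans (at-u 0 z≤n) (cong (at ω) φ0≡0))) (cong (LEW ω) (sym φ0≡0))
    LEW-u (suc a) a+1≤ with φ-step a a+1≤
    ... | inj₁ e = begin
      eraseStep (LEW u a) (at u (suc a))          ≡⟨ cong₂ eraseStep (LEW-u a a≤) (at-u (suc a) a+1≤) ⟩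
      eraseStep (LEW ω (φ a)) (at ω (φ (suc a)))  ≡⟨ cong (λ z → eraseStep (LEW ω (φ a)) (at ω z)) e ⟩
      LEW ω (suc (φ a))                            ≡⟨ cong (LEW ω) (sym e) ⟩
      LEW ω (φ (suc a))                            ∎
      where open ≡-Reasoning ; a≤ = ≤-trans (n≤1+n a) a+1≤
    ... | inj₂ (k' , e , anc) = begin
      eraseStep (LEW u a) (at u (suc a))          ≡⟨ cong₂ eraseStep (trans (LEW-u a a≤) (sym (LEW-loop anc))) (at-u (suc a) a+1≤) ⟩
      eraseStep (LEW ω k') (at ω (φ (suc a)))     ≡⟨ cong (λ z → eraseStep (LEW ω k') (at ω z)) e ⟩
      LEW ω (suc k')                               ≡⟨ cong (LEW ω) (sym e) ⟩
      LEW ω (φ (suc a))                            ∎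
      where open ≡-Reasoning ; a≤ = ≤-trans (n≤1+n a) a+1≤

    Revisits-ω⇒u : ∀ {a b} → a < b → b ≤ lastIx u → Revisits ω (φ a) (φ b) → Revisits u a b
    Revisits-ω⇒u {a} {b} a<b b≤ (e , stays) = trans (at-u a a≤) (trans e (sym (at-u b b≤))) , stays-u
      where
      a≤ = ≤-trans (<⇒≤ a<b) b≤
      stays-u : ∀ t → a ≤ t → t < b → at u a ∈ LEW u t
      stays-u t a≤t t<b = subst₂ _∈_ (sym (at-u a a≤)) (sym (LEW-u t t≤))
                            (stays (φ t) (φ-mono-≤ a≤t t≤) (φ-mono-< t<b b≤))
        where t≤ = ≤-trans (<⇒≤ t<b) b≤

    Revisits-u⇒ω : ∀ {a b} → a < b → b ≤ lastIx u → Revisits u a b → Revisits ω (φ a) (φ b)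
    Revisits-u⇒ω {a} {b} a<b b≤ (e , stays) = trans (sym (at-u a a≤)) (trans e (at-u b b≤)) , stays-ω b a<b ≤-refl
      where
      a≤ = ≤-trans (<⇒≤ a<b) b≤
      y = at ω (φ a)
      y∈ : ∀ t → a ≤ t → t < b → y ∈ LEW ω (φ t)
      y∈ t a≤t t<b = subst₂ _∈_ (at-u a a≤) (LEW-u t (≤-trans (<⇒≤ t<b) b≤)) (stays t a≤t t<b)
      stays-ω : ∀ c → a < c → c ≤ b → ∀ t → φ a ≤ t → t < φ c → y ∈ LEW ω t
      stays-ω (suc c) (s≤s a≤c) c+1≤b t φa≤t t<φ[c+1] with t <? φ c
      ... | yes t<φc with m≤n⇒m<n∨m≡n a≤c
      ...   | inj₁ a<c  = stays-ω c a<c (≤-trans (n≤1+n c) c+1≤b) t φa≤t t<φc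
      ...   | inj₂ refl = ⊥-elim (<-irrefl refl (≤-<-trans φa≤t t<φc))
      stays-ω (suc c) (s≤s a≤c) c+1≤b t φa≤t t<φ[c+1] | no t≮φc with φ-step c (≤-trans c+1≤b b≤)
      ... | inj₁ e′ = subst (λ z → y ∈ LEW ω z) (≤-antisym (≮⇒≥ t≮φc) (≤-pred (subst (t <_) e′ t<φ[c+1]))) (y∈ c a≤c c+1≤b)
      ... | inj₂ (k' , e′ , anc) = Ancestor-keeps-LEW anc (y∈ c a≤c c+1≤b) t (≮⇒≥ t≮φc) (≤-pred (subst (t <_) e′ t<φ[c+1]))

    Ancestor-u⇒ω : ∀ {a b} → a < b → b ≤ lastIx u → Ancestor u a b → Ancestor ω (φ a) (φ b)
    Ancestor-u⇒ω a<b b≤ anc = Revisits⇒Ancestor ω _ _ (φ-mono-< a<b b≤) (Revisits-u⇒ω a<b b≤ (Ancestor⇒Revisits anc))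

    Ancestor-ω⇒u : ∀ {a b} → a < b → b ≤ lastIx u → Ancestor ω (φ a) (φ b) → Ancestor u a b
    Ancestor-ω⇒u a<b b≤ anc = Revisits⇒Ancestor u _ _ a<b (Revisits-ω⇒u a<b b≤ (Ancestor⇒Revisits anc))

  SamePattern : Walk → Walk → Set
  SamePattern u v = (length u ≡ length v) ×
    (∀ i j → i < length u → j < length u → (at u i ≡ at u j → at v i ≡ at v j) × (at v i ≡ at v j → at u i ≡ at u j))

  firstIndex : ℕ → List ℕ → ℕ
  firstIndex x []       = 0
  firstIndex x (y ∷ xs) = if x ≡ᵇ y then 0 else suc (firstIndex x xs)

  firstIndex-correct : ∀ x xs → x ∈ xs → (firstIndex x xs < length xs) × (at xs (firstIndex x xs) ≡ x)
  firstIndex-correct x (y ∷ xs) x∈ with x ≡ᵇ y in e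
  ... | true = s≤s z≤n , sym (≡ᵇ-true⇒≡ x y e)
  ... | false with x∈
  ...   | here x≡y  = ⊥-elim (≡ᵇ-false⇒≢ x y e x≡y)
  ...   | there x∈′ = let (i< , at≡) = firstIndex-correct x xs x∈′ in s≤s i< , at≡

  module _ (u v : Walk) (same : SamePattern u v) where

    -- vertices not in u are sent beyond max v, so that they cannot collide with the others
    relabelling : ℕ → ℕ
    relabelling x = if elem x u then at v (firstIndex x u) else suc (maxList v) + x

    private
      M = maxList v
      len = proj₁ same
      same-at = proj₂ same

      relabelling-in : ∀ {x} → x ∈ u → relabelling x ≡ at v (firstIndex x u)
      relabelling-in {x} x∈ rewrite ∈⇒elem x u x∈ = refl

      relabelling-out : ∀ {x} → elem x u ≡ false → relabelling x ≡ suc M + x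
      relabelling-out x∉ rewrite x∉ = refl

      relabelling-in-≤ : ∀ {x} → x ∈ u → relabelling x ≤ M
      relabelling-in-≤ {x} x∈ = subst (_≤ M) (sym (relabelling-in x∈))
        (≤maxList v (at∈ v (subst (_ <_) len (proj₁ (firstIndex-correct x u x∈)))))

      in≢out : ∀ {x y} → x ∈ u → elem y u ≡ false → relabelling x ≢ relabelling y
      in≢out {y = y} x∈ y∉ e = <-irrefl refl (≤-<-trans (subst (_≤ M) e (relabelling-in-≤ x∈))
                                                         (subst (M <_) (sym (relabelling-out y∉)) (s≤s (m≤m+n M y))))

    relabelling-injective : Injective _≡_ _≡_ relabelling
    relabelling-injective {x} {y} e with true-or-false (elem x u) | true-or-false (elem y u)
    ... | inj₁ x∈ | inj₁ y∈ = trans (sym (proj₂ ix)) (trans (proj₂ (same-at _ _ (proj₁ ix) (proj₁ iy)) v-eq) (proj₂ iy))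
      where
      ix = firstIndex-correct x u (elem⇒∈ x u x∈)
      iy = firstIndex-correct y u (elem⇒∈ y u y∈)
      v-eq = trans (sym (relabelling-in (elem⇒∈ x u x∈))) (trans e (relabelling-in (elem⇒∈ y u y∈)))
    ... | inj₂ x∉ | inj₂ y∉ = +-cancelˡ-≡ (suc M) x y (trans (sym (relabelling-out x∉)) (trans e (relabelling-out y∉)))
    ... | inj₁ x∈ | inj₂ y∉ = ⊥-elim (in≢out (elem⇒∈ x u x∈) y∉ e)
    ... | inj₂ x∉ | inj₁ y∈ = ⊥-elim (in≢out (elem⇒∈ y u y∈) x∉ (sym e))

    map-relabelling : map relabelling u ≡ v
    map-relabelling = ≡-by-at (map relabelling u) v (trans (length-map relabelling u) len) at≡
      where
      at≡ : ∀ i → i < length (map relabelling u) → at (map relabelling u) i ≡ at v i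
      at≡ i i< = trans (at-map relabelling u i<u)
                   (trans (relabelling-in (at∈ u i<u)) (proj₁ (same-at _ i (proj₁ fi) i<u) (proj₂ fi)))
        where
        i<u = subst (i <_) (length-map relabelling u) i<
        fi = firstIndex-correct (at u i) u (at∈ u i<u)

  SamePattern-C : ∀ ω u v (ψ : ℕ → ℕ) → length (C u) ≡ length v →
    (∀ i → i ≤ lastIx u → at v i ≡ label ω (ψ i)) →
    (∀ {i j} → i < j → j ≤ lastIx u → ψ i < ψ j) →
    (∀ {i j} → i < j → j ≤ lastIx u → Ancestor u i j → Ancestor ω (ψ i) (ψ j)) →
    (∀ {i j} → i < j → j ≤ lastIx u → Ancestor ω (ψ i) (ψ j) → Ancestor u i j) → SamePattern (C u) v
  SamePattern-C ω u v ψ len at-v ψ-mono u⇒ω ω⇒u = len , λ i j i< j< → both (<length-C⇒≤lastIx u i<) (<length-C⇒≤lastIx u j<)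
    where
    Both : ℕ → ℕ → Set
    Both i j = (at (C u) i ≡ at (C u) j → at v i ≡ at v j) × (at v i ≡ at v j → at (C u) i ≡ at (C u) j)
    v≡⇔Ancestor : ∀ {i j} → i < j → j ≤ lastIx u → (at v i ≡ at v j → Ancestor ω (ψ i) (ψ j)) × (Ancestor ω (ψ i) (ψ j) → at v i ≡ at v j)
    v≡⇔Ancestor {i} {j} i<j j≤ =
      (λ e → label≡⇒Ancestor ω (ψ-mono i<j j≤) (trans (sym (at-v i i≤)) (trans e (at-v j j≤)))) ,
      (λ anc → trans (at-v i i≤) (trans (Ancestor-label anc) (sym (at-v j j≤))))
      where i≤ = ≤-trans (<⇒≤ i<j) j≤
    ordered : ∀ {i j} → i < j → j ≤ lastIx u → Both i j
    ordered i<j j≤ =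
      (λ e → proj₂ (v≡⇔Ancestor i<j j≤) (u⇒ω i<j j≤ (proj₁ (label≡⇔Ancestor u i<j j≤) e))) ,
      (λ e → proj₂ (label≡⇔Ancestor u i<j j≤) (ω⇒u i<j j≤ (proj₁ (v≡⇔Ancestor i<j j≤) e)))
    both : ∀ {i j} → i ≤ lastIx u → j ≤ lastIx u → Both i j
    both {i} {j} i≤ j≤ with <-cmp i j
    ... | tri< i<j _ _ = ordered i<j j≤
    ... | tri≈ _ refl _ = (λ _ → refl) , (λ _ → refl)
    ... | tri> _ _ j<i = let (f , g) = ordered j<i i≤ in (λ e → sym (f (sym e))) , (λ e → sym (g (sym e)))

  module LoopSlice (ω : Walk) {k k' : ℕ} (anc : Ancestor ω k k') (k'≤ : k' ≤ lastIx ω) where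

    u = slice ω k k'
    m = k' ∸ k

    private
      k≤k' : k ≤ k'
      k≤k' = <⇒≤ (Ancestor-< anc)

      k'<length : k' < length ω
      k'<length = 0<≤lastIx⇒<length ω (≤-<-trans z≤n (Ancestor-< anc)) k'≤

      k+i≤k' : ∀ {i} → i ≤ m → k + i ≤ k'
      k+i≤k' i≤m = subst (k + _ ≤_) (m+[n∸m]≡n k≤k') (+-monoʳ-≤ k i≤m)

    at-u : ∀ {i} → i ≤ m → at u i ≡ at ω (k + i)
    at-u i≤m = at-slice ω k k' (k+i≤k' i≤m)

    lastIx-u : lastIx u ≡ m
    lastIx-u = cong (_∸ 1) (trans (length-slice ω k k' k'<length) (+-∸-assoc 1 k≤k'))

    at∉below : ∀ i → i ≤ m → at ω (k + i) ∉ stackBelow ω k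
    at∉below zero    _      rewrite +-identityʳ k = at∉stackBelow ω k
    at∉below (suc i) i+1≤m x∈below rewrite +-suc k i =
      stackBelow-pops ω k (k + i) (m≤m+n k i) (StaysOn-≤ (Ancestor-stays anc) (≤-trans (n≤1+n _) k+i+1≤k')) x∈below
        (Ancestor-stays anc (suc (k + i)) (≤-trans (m≤m+n k i) (n≤1+n _)) k+i+1≤k')
      where
      k+i+1≤k' : suc (k + i) ≤ k'
      k+i+1≤k' = subst (_≤ k') (+-suc k i) (k+i≤k' i+1≤m)

    LEW-ω : ∀ i → i ≤ m → LEW ω (k + i) ≡ stackBelow ω k ++ LEW u i
    LEW-ω zero    _ rewrite +-identityʳ k = trans (LEW≡stackBelow++ ω k) (cong (λ z → stackBelow ω k ++ [ z ]) (sym at-u0))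
      where
      at-u0 : at u 0 ≡ at ω k
      at-u0 = trans (at-u z≤n) (cong (at ω) (+-identityʳ k))
    LEW-ω (suc i) i+1≤m = begin
      LEW ω (k + suc i)                                ≡⟨ cong (LEW ω) (+-suc k i) ⟩
      eraseStep (LEW ω (k + i)) x                      ≡⟨ cong (λ L → eraseStep L x) (LEW-ω i (≤-trans (n≤1+n i) i+1≤m)) ⟩
      eraseStep (stackBelow ω k ++ LEW u i) x          ≡⟨ eraseStep-++ x (stackBelow ω k) (LEW u i) x∉below ⟩
      stackBelow ω k ++ eraseStep (LEW u i) x          ≡⟨ cong (λ z → stackBelow ω k ++ eraseStep (LEW u i) z) (sym at-u′) ⟩
      stackBelow ω k ++ LEW u (suc i)                  ∎
      where
      open ≡-Reasoning
      x = at ω (suc (k + i))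
      x∉below : x ∉ stackBelow ω k
      x∉below = subst (_∉ stackBelow ω k) (cong (at ω) (+-suc k i)) (at∉below (suc i) i+1≤m)
      at-u′ : at u (suc i) ≡ x
      at-u′ = trans (at-u i+1≤m) (cong (at ω) (+-suc k i))

    Revisits-u⇒ω : ∀ {i j} → i < j → j ≤ m → Revisits u i j → Revisits ω (k + i) (k + j)
    Revisits-u⇒ω {i} {j} i<j j≤m (e , stays) = trans (sym (at-u i≤m)) (trans e (at-u j≤m)) , stays-ω
      where
      i≤m = ≤-trans (<⇒≤ i<j) j≤m
      stays-ω : ∀ t → k + i ≤ t → t < k + j → at ω (k + i) ∈ LEW ω t
      stays-ω t k+i≤t t<k+j = subst (λ z → at ω (k + i) ∈ LEW ω z) (m+[n∸m]≡n k≤t)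
        (subst (at ω (k + i) ∈_) (sym (LEW-ω (t ∸ k) (<⇒≤ (<-≤-trans t∸k<j j≤m))))
          (∈-++⁺ʳ (stackBelow ω k) (subst (_∈ LEW u (t ∸ k)) (at-u i≤m) (stays (t ∸ k) i≤t∸k t∸k<j))))
        where
        k≤t = ≤-trans (m≤m+n k i) k+i≤t
        i≤t∸k = subst (_≤ t ∸ k) (m+n∸m≡n k i) (∸-monoˡ-≤ k k+i≤t)
        t∸k<j = subst (t ∸ k <_) (m+n∸m≡n k j) (∸-monoˡ-< t<k+j k≤t)

    Revisits-ω⇒u : ∀ {i j} → i < j → j ≤ m → Revisits ω (k + i) (k + j) → Revisits u i j
    Revisits-ω⇒u {i} {j} i<j j≤m (e , stays) = trans (at-u i≤m) (trans e (sym (at-u j≤m))) , stays-u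
      where
      i≤m = ≤-trans (<⇒≤ i<j) j≤m
      stays-u : ∀ t → i ≤ t → t < j → at u i ∈ LEW u t
      stays-u t i≤t t<j with ∈-++⁻ (stackBelow ω k) (subst (at ω (k + i) ∈_) (LEW-ω t (<⇒≤ (<-≤-trans t<j j≤m)))
                                                      (stays (k + t) (+-monoʳ-≤ k i≤t) (+-monoʳ-< k t<j)))
      ... | inj₁ x∈below = ⊥-elim (at∉below i i≤m x∈below)
      ... | inj₂ x∈      = subst (_∈ LEW u t) (sym (at-u i≤m)) x∈

    SamePattern-slice : SamePattern (C u) (slice (C ω) k k')
    SamePattern-slice = SamePattern-C ω u (slice (C ω) k k') (k +_) len at-v (λ i<j _ → +-monoʳ-< k i<j)
      (λ i<j j≤ a → Revisits⇒Ancestor ω _ _ (+-monoʳ-< k i<j) (Revisits-u⇒ω i<j (≤m j≤) (Ancestor⇒Revisits a)))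
      (λ i<j j≤ a → Revisits⇒Ancestor u _ _ i<j (Revisits-ω⇒u i<j (≤m j≤) (Ancestor⇒Revisits a)))
      where
      ≤m : ∀ {i} → i ≤ lastIx u → i ≤ m
      ≤m {i} = subst (i ≤_) lastIx-u
      k'<length-C : k' < length (C ω)
      k'<length-C = subst (k' <_) (sym (length-cactusUpto ω (lastIx ω))) (s≤s k'≤)
      len : length (C u) ≡ length (slice (C ω) k k')
      len = begin
        length (C u)              ≡⟨ length-cactusUpto u (lastIx u) ⟩
        suc (lastIx u)            ≡⟨ cong suc lastIx-u ⟩
        suc m                     ≡⟨ sym (+-∸-assoc 1 k≤k') ⟩
        suc k' ∸ k                ≡⟨ sym (length-slice (C ω) k k' k'<length-C) ⟩
        length (slice (C ω) k k') ∎
        where open ≡-Reasoning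
      at-v : ∀ i → i ≤ lastIx u → at (slice (C ω) k k') i ≡ label ω (k + i)
      at-v i i≤ = trans (at-slice (C ω) k k' (k+i≤k' (≤m i≤))) (at-C ω (≤-trans (k+i≤k' (≤m i≤)) k'≤))

  Sorted : List ℕ → Set
  Sorted = AllPairs _<_

  upTo-sorted : ∀ n → Sorted (upTo n)
  upTo-sorted n = AllPairs.applyUpTo⁺₁ (λ i → i) n (λ i<j _ → i<j)

  bfilter-sorted : ∀ (p : ℕ → Bool) {L} → Sorted L → Sorted (bfilter p L)
  bfilter-sorted p {[]}    []           = []
  bfilter-sorted p {x ∷ L} (x< ∷ sorted) with p x
  ... | true  = All.tabulate (λ y∈ → All.lookup x< (proj₁ (bfilter⁻ p L y∈))) ∷ bfilter-sorted p sorted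
  ... | false = bfilter-sorted p sorted

  sorted-step : ∀ {L} → Sorted L → ∀ {a} → suc a < length L → at L a < at L (suc a)
  sorted-step {x ∷ y ∷ L} (x< ∷ _)      {zero}  _         = All.head x<
  sorted-step {x ∷ L}     (_ ∷ sorted) {suc a} (s≤s a<) = sorted-step sorted a<

  sorted-head-≤ : ∀ {L w} → Sorted L → w ∈ L → at L 0 ≤ w
  sorted-head-≤ (x< ∷ _) (here refl) = ≤-refl
  sorted-head-≤ (x< ∷ _) (there w∈)  = <⇒≤ (All.lookup x< w∈)

  bfilter-gap : ∀ (p : ℕ → Bool) {L} → Sorted L → ∀ a → suc a < length (bfilter p L) → ∀ {z} → z ∈ L →
    at (bfilter p L) a < z → z < at (bfilter p L) (suc a) → p z ≡ false
  bfilter-gap p {x ∷ L} (x< ∷ sorted) a a+1< z∈ lo hi with p x in px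
  bfilter-gap p {x ∷ L} (x< ∷ sorted) zero a+1< (here refl) lo hi | true = ⊥-elim (<-irrefl refl lo)
  bfilter-gap p {x ∷ L} (x< ∷ sorted) zero a+1< {z} (there z∈) lo hi | true with p z in pz
  ... | false = refl
  ... | true  = ⊥-elim (<-irrefl refl (<-≤-trans hi (sorted-head-≤ (bfilter-sorted p sorted) (bfilter⁺ p L z∈ pz))))
  bfilter-gap p {x ∷ L} (x< ∷ sorted) (suc a) (s≤s a+1<) (here refl) lo hi | true =
    ⊥-elim (<-irrefl refl (<-trans (All.lookup x< (proj₁ (bfilter⁻ p L (at∈ (bfilter p L) (<-trans (n<1+n a) a+1<))))) lo))
  bfilter-gap p {x ∷ L} (x< ∷ sorted) (suc a) (s≤s a+1<) (there z∈) lo hi | true = bfilter-gap p sorted a a+1< z∈ lo hi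
  bfilter-gap p {x ∷ L} (x< ∷ sorted) a a+1< (here refl) lo hi | false = px
  bfilter-gap p {x ∷ L} (x< ∷ sorted) a a+1< (there z∈) lo hi | false = bfilter-gap p sorted a a+1< z∈ lo hi

  kept : List Pair → ℕ → Bool
  kept cs i = not (any (λ p → (proj₁ p <ᵇ i) ∧ (i ≤ᵇ proj₂ p)) cs)

  keptPositions : List Pair → ℕ → List ℕ
  keptPositions cs n = bfilter (kept cs) (upTo n)

  map-at-shift : ∀ x v (p : ℕ → Bool) n →
    map (at (x ∷ v)) (bfilter p (applyUpTo suc n)) ≡ map (at v) (bfilter (p ∘ suc) (upTo n))
  map-at-shift x v p n = begin
    map (at (x ∷ v)) (bfilter p (applyUpTo suc n))          ≡⟨ cong (λ L → map (at (x ∷ v)) (bfilter p L)) (sym (map-upTo suc n)) ⟩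
    map (at (x ∷ v)) (bfilter p (map suc (upTo n)))         ≡⟨ cong (map (at (x ∷ v))) (bfilter-map p suc (upTo n)) ⟩
    map (at (x ∷ v)) (map suc (bfilter (p ∘ suc) (upTo n))) ≡⟨ sym (map-∘ (bfilter (p ∘ suc) (upTo n))) ⟩
    map (at v) (bfilter (p ∘ suc) (upTo n))                 ∎
    where open ≡-Reasoning

  map-proj₂-bfilter-zip : ∀ (K : ℕ → Bool) (f : ℕ → ℕ) v →
    map proj₂ (bfilter (λ iw → K (proj₁ iw)) (zip (applyUpTo f (length v)) v)) ≡ map (at v) (bfilter (K ∘ f) (upTo (length v)))
  map-proj₂-bfilter-zip K f []      = refl
  map-proj₂-bfilter-zip K f (x ∷ v) with K (f 0)
  ... | true  = cong (x ∷_) (trans (map-proj₂-bfilter-zip K (f ∘ suc) v) (sym (map-at-shift x v (K ∘ f) (length v))))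
  ... | false = trans (map-proj₂-bfilter-zip K (f ∘ suc) v) (sym (map-at-shift x v (K ∘ f) (length v)))

  lowerCut≡ : ∀ v cs → lowerCut v cs ≡ map (at v) (keptPositions cs (length v))
  lowerCut≡ v cs = map-proj₂-bfilter-zip (kept cs) (λ i → i) v

  kept-zero : ∀ cs → kept cs 0 ≡ true
  kept-zero []       = refl
  kept-zero (p ∷ cs) = kept-zero cs

  kept-false⇒cut : ∀ cs {i} → kept cs i ≡ false → Σ Pair λ p → (p ∈ cs) × (proj₁ p < i) × (i ≤ proj₂ p)
  kept-false⇒cut cs {i} e with any⁻ _ cs (not-false⇒true e)
  ... | p , p∈ , fp with ∧-true⁻ {proj₁ p <ᵇ i} fp
  ...   | e₁ , e₂ = p , p∈ , <ᵇ-true⇒< _ _ e₁ , ≤ᵇ-true⇒≤ _ _ e₂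

  kept-true⇒uncut : ∀ cs {i} → kept cs i ≡ true → ∀ {p} → p ∈ cs → proj₁ p < i → i ≤ proj₂ p → ⊥
  kept-true⇒uncut cs {i} e p∈ lo hi =
    false≢true (trans (sym (not-true⇒false e)) (any⁺ _ cs p∈ (cong₂ _∧_ (<⇒<ᵇ-true lo) (≤⇒≤ᵇ-true hi))))

  CutChain : List Pair → Set
  CutChain = Linked (λ p q → proj₂ p < proj₁ q)

  WellFormedCuts : Walk → List Pair → Set
  WellFormedCuts ω cs = ∀ {p} → p ∈ cs → (proj₂ p ≤ lastIx ω) × Ancestor ω (proj₁ p) (proj₂ p)

  chain-∷ : ∀ {p cs} → CutChain cs → (∀ {q r} → cs ≡ q ∷ r → (proj₂ p <ᵇ proj₁ q) ≡ true) → CutChain (p ∷ cs)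
  chain-∷ {cs = []}    _     _  = [-]
  chain-∷ {cs = q ∷ r} chain hd = <ᵇ-true⇒< _ _ (hd refl) ∷ chain

  ∈-chains⁻ : ∀ n ok L {cs} → cs ∈ chains n ok L →
    (∀ {p} → p ∈ cs → p ∈ L) × CutChain cs × (∀ {p r} → cs ≡ p ∷ r → ok (proj₁ p) ≡ true)
  ∈-chains⁻ zero    ok L (here refl) = (λ ()) , [] , λ ()
  ∈-chains⁻ (suc n) ok L (here refl) = (λ ()) , [] , λ ()
  ∈-chains⁻ (suc n) ok L (there cs∈) with find (∈-concatMap⁻ _ {xs = L} cs∈)
  ... | p , p∈L , cs∈′ with ok (proj₁ p) in okp | cs∈′
  ...   | false | ()
  ...   | true  | cs∈″ with ∈-map⁻ (p ∷_) cs∈″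
  ...     | cs′ , cs′∈ , refl with ∈-chains⁻ n (λ a → proj₂ p <ᵇ a) L cs′∈
  ...       | ⊆L , chain , head-ok = ⊆L′ , chain-∷ chain head-ok , λ { refl → okp }
    where
    ⊆L′ : ∀ {q} → q ∈ p ∷ cs′ → q ∈ L
    ⊆L′ (here refl) = p∈L
    ⊆L′ (there q∈)  = ⊆L q∈

  chain-after : ∀ {p r} → CutChain (p ∷ r) → (∀ {q} → q ∈ p ∷ r → proj₁ q < proj₂ q) → ∀ {q} → q ∈ r → proj₂ p < proj₁ q
  chain-after (lt ∷ chain) wf (here refl) = lt
  chain-after (lt ∷ chain) wf (there q∈)  =
    <-trans lt (<-trans (wf (there (here refl))) (chain-after chain (λ q∈′ → wf (there q∈′)) q∈))

  chain-disjoint : ∀ {cs} → CutChain cs → (∀ {q} → q ∈ cs → proj₁ q < proj₂ q) →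
    ∀ {p q} → p ∈ cs → q ∈ cs → (p ≡ q) ⊎ (proj₂ p < proj₁ q) ⊎ (proj₂ q < proj₁ p)
  chain-disjoint ch wf (here refl) (here refl) = inj₁ refl
  chain-disjoint ch wf (here refl) (there q∈)  = inj₂ (inj₁ (chain-after ch wf q∈))
  chain-disjoint ch wf (there p∈)  (here refl) = inj₂ (inj₂ (chain-after ch wf p∈))
  chain-disjoint ch wf (there p∈)  (there q∈)  = chain-disjoint (Linked.tail ch) (λ r∈ → wf (there r∈)) p∈ q∈

  ∈EAdC⇒ : ∀ ω {cs} → cs ∈ EAdC ω → (cs ≢ []) × CutChain cs × WellFormedCuts ω cs
  ∈EAdC⇒ ω {cs} cs∈ with bfilter⁻ _ (chains (length (AdC ω)) (λ _ → true) (AdC ω)) cs∈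
  ... | cs∈chains , nonnull with ∈-chains⁻ (length (AdC ω)) (λ _ → true) (AdC ω) cs∈chains
  ...   | ⊆AdC , chain , _ = (λ { refl → false≢true nonnull }) , chain , wellFormed
    where
    wellFormed : WellFormedCuts ω cs
    wellFormed {k , k'} p∈ = inLES⇒Ancestor ω k k' (proj₁ (∧-true⁻ {inLES ω k k'} (proj₂ (bfilter⁻ (admissible ω) (allPairs (lastIx ω)) (⊆AdC p∈)))))

  module LowerCut (ω : Walk) (cs : List Pair) (ω≢[] : ω ≢ []) (chain : CutChain cs) (wellFormed : WellFormedCuts ω cs) where

    n = length ω
    L = keptPositions cs n
    u = lowerCut ω cs

    φ : ℕ → ℕ
    φ = at L

    private
      L-sorted : Sorted L
      L-sorted = bfilter-sorted (kept cs) (upTo-sorted n)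

      ∈L⁻ : ∀ {x} → x ∈ L → (x < n) × (kept cs x ≡ true)
      ∈L⁻ x∈ = let (x∈upTo , kx) = bfilter⁻ (kept cs) (upTo n) x∈ in ∈-upTo⁻ x∈upTo , kx

      0∈L : 0 ∈ L
      0∈L = bfilter⁺ (kept cs) (upTo n) (∈-upTo⁺ (≤lastIx⇒<length ω ω≢[] z≤n)) (kept-zero cs)

      u≡ : u ≡ map (at ω) L
      u≡ = lowerCut≡ ω cs

      length-u : length u ≡ length L
      length-u = trans (cong length u≡) (length-map (at ω) L)

      u≢[] : u ≢ []
      u≢[] e = map-nonempty 0∈L (trans (sym u≡) e)
        where
        map-nonempty : ∀ {M : List ℕ} → 0 ∈ M → map (at ω) M ≢ []
        map-nonempty {_ ∷ _} _ ()

      <length-L : ∀ {a} → a ≤ lastIx u → a < length L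
      <length-L a≤ = subst (_ <_) length-u (≤lastIx⇒<length u u≢[] a≤)

      φ<n : ∀ {a} → a < length L → φ a < n
      φ<n a< = proj₁ (∈L⁻ (at∈ L a<))

      φ-kept : ∀ {a} → a < length L → kept cs (φ a) ≡ true
      φ-kept a< = proj₂ (∈L⁻ (at∈ L a<))

      φ0≡0 : φ 0 ≡ 0
      φ0≡0 = n≤0⇒n≡0 (sorted-head-≤ L-sorted 0∈L)

      at-u : ∀ a → a ≤ lastIx u → at u a ≡ at ω (φ a)
      at-u a a≤ = trans (cong (λ v → at v a) u≡) (at-map (at ω) L (<length-L a≤))

      cut-< : ∀ {q} → q ∈ cs → proj₁ q < proj₂ q
      cut-< q∈ = Ancestor-< (proj₂ (wellFormed q∈))

      skipped-cut : ∀ a → suc a < length L → φ (suc a) ≢ suc (φ a) →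
        Σ Pair λ p → (p ∈ cs) × (proj₁ p ≡ φ a) × (φ (suc a) ≡ suc (proj₂ p))
      skipped-cut a a+1< y≢x+1 = p , p∈ , p₁≡x , y≡p₂+1
        where
        x = φ a
        y = φ (suc a)
        x<y : x < y
        x<y = sorted-step L-sorted a+1<
        x+1<y : suc x < y
        x+1<y = ≤∧≢⇒< x<y (λ e → y≢x+1 (sym e))
        x-kept = φ-kept (<-trans (n<1+n a) a+1<)
        y-kept = φ-kept a+1<
        gap : ∀ {z} → x < z → z < y → kept cs z ≡ false
        gap x<z z<y = bfilter-gap (kept cs) (upTo-sorted n) a a+1< (∈-upTo⁺ (<-trans z<y (φ<n a+1<))) x<z z<y
        cut = kept-false⇒cut cs (gap ≤-refl x+1<y)
        p = proj₁ cut
        p∈ = proj₁ (proj₂ cut)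
        p₁≡x : proj₁ p ≡ x
        p₁≡x with m≤n⇒m<n∨m≡n (≤-pred (proj₁ (proj₂ (proj₂ cut))))
        ... | inj₂ e   = e
        ... | inj₁ p₁<x = ⊥-elim (kept-true⇒uncut cs x-kept p∈ p₁<x (<⇒≤ (proj₂ (proj₂ (proj₂ cut)))))
        x<p₂+1 : x < suc (proj₂ p)
        x<p₂+1 = <-trans (n<1+n x) (s≤s (proj₂ (proj₂ (proj₂ cut))))
        p₂<y : proj₂ p < y
        p₂<y with proj₂ p <? y
        ... | yes p₂<y = p₂<y
        ... | no p₂≮y  = ⊥-elim (kept-true⇒uncut cs y-kept p∈ (subst (_< y) (sym p₁≡x) x<y) (≮⇒≥ p₂≮y))
        -- a cut r covering p₂ + 1 < y would overlap p
        y≡p₂+1 : y ≡ suc (proj₂ p)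
        y≡p₂+1 with suc (proj₂ p) <? y
        ... | no p₂+1≮y = ≤-antisym (≮⇒≥ p₂+1≮y) p₂<y
        ... | yes p₂+1<y with kept-false⇒cut cs (gap x<p₂+1 p₂+1<y)
        ...   | r , r∈ , r₁<p₂+1 , p₂+1≤r₂ with chain-disjoint chain cut-< p∈ r∈
        ...     | inj₁ refl        = ⊥-elim (<-irrefl refl p₂+1≤r₂)
        ...     | inj₂ (inj₁ p₂<r₁) = ⊥-elim (<-irrefl refl (<-≤-trans p₂<r₁ (≤-pred r₁<p₂+1)))
        ...     | inj₂ (inj₂ r₂<p₁) = ⊥-elim (<-irrefl refl (<-≤-trans (<-≤-trans r₂<p₁ (subst (_≤ x) (sym p₁≡x) ≤-refl)) (≤-trans (<⇒≤ x<p₂+1) p₂+1≤r₂)))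

      φ-step : ∀ a → suc a ≤ lastIx u → (φ (suc a) ≡ suc (φ a)) ⊎ (Σ ℕ λ k' → (φ (suc a) ≡ suc k') × Ancestor ω (φ a) k')
      φ-step a a+1≤ with φ (suc a) ≟ℕ suc (φ a)
      ... | yes e     = inj₁ e
      ... | no y≢x+1 with skipped-cut a (<length-L a+1≤) y≢x+1
      ...   | p , p∈ , p₁≡x , y≡ = inj₂ (proj₂ p , y≡ , subst (λ z → Ancestor ω z (proj₂ p)) p₁≡x (proj₂ (wellFormed p∈)))

    open LoopSkipping ω u φ φ0≡0 at-u φ-step

    SamePattern-lowerCut : SamePattern (C u) (lowerCut (C ω) cs)
    SamePattern-lowerCut = SamePattern-C ω u (lowerCut (C ω) cs) φ len at-v φ-mono-< Ancestor-u⇒ω Ancestor-ω⇒u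
      where
      lowerCut-C≡ : lowerCut (C ω) cs ≡ map (at (C ω)) L
      lowerCut-C≡ = trans (lowerCut≡ (C ω) cs) (cong (λ m → map (at (C ω)) (keptPositions cs m)) (length-C ω ω≢[]))
      len : length (C u) ≡ length (lowerCut (C ω) cs)
      len = trans (length-C u u≢[]) (trans length-u (trans (sym (length-map (at (C ω)) L)) (cong length (sym lowerCut-C≡))))
      at-v : ∀ i → i ≤ lastIx u → at (lowerCut (C ω) cs) i ≡ label ω (φ i)
      at-v i i≤ = trans (cong (λ v → at v i) lowerCut-C≡)
        (trans (at-map (at (C ω)) L (<length-L i≤)) (at-C ω (<length⇒≤lastIx ω (φ<n (<length-L i≤)))))

open LoopErasure

-- Equality modulo a subspace

module _ {c ℓ : Level} (R : CommutativeRing c ℓ) where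

  open CommutativeRing R using (Carrier; _≈_; _+_; _*_; -_; 0#; 1#; setoid; ring; +-cong; +-identityˡ; +-identityʳ;
    +-assoc; *-identityʳ; -‿inverseˡ; -‿inverseʳ; -‿cong) renaming (refl to ≈-refl; sym to ≈-sym; trans to ≈-trans; reflexive to ≈-reflexive)
  open RingProperties ring using (-‿distribʳ-*; -‿involutive)
  open CommutativeSemigroupProperties (CommutativeRing.+-commutativeSemigroup R) using (interchange)
  open Over R
  open SetoidReasoning setoid

  -x*1≈-x : ∀ x → - x * 1# ≈ - x
  -x*1≈-x x = *-identityʳ (- x)

  -x*-1≈x : ∀ x → - x * - 1# ≈ x
  -x*-1≈x x = ≈-trans (≈-sym (-‿distribʳ-* (- x) 1#)) (≈-trans (-‿cong (-x*1≈-x x)) (-‿involutive x))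

  module _ {B : Set} (_≟_ : DecidableEquality B) where

    coeff-∷ : ∀ r P xs b → coeff _≟_ ((r , P) ∷ xs) b ≈ coeff _≟_ [ (r , P) ] b + coeff _≟_ xs b
    coeff-∷ r P xs b with P ≟ b
    ... | yes _ = +-cong (≈-sym (+-identityʳ r)) ≈-refl
    ... | no _  = ≈-sym (+-identityˡ _)

    coeff-++ : ∀ xs ys b → coeff _≟_ (xs ++ ys) b ≈ coeff _≟_ xs b + coeff _≟_ ys b
    coeff-++ []             ys b = ≈-sym (+-identityˡ _)
    coeff-++ ((r , P) ∷ xs) ys b = begin
      coeff _≟_ ((r , P) ∷ (xs ++ ys)) b                          ≈⟨ coeff-∷ r P (xs ++ ys) b ⟩
      coeff _≟_ [ (r , P) ] b + coeff _≟_ (xs ++ ys) b            ≈⟨ +-cong ≈-refl (coeff-++ xs ys b) ⟩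
      coeff _≟_ [ (r , P) ] b + (coeff _≟_ xs b + coeff _≟_ ys b) ≈⟨ +-assoc _ _ _ ⟨
      (coeff _≟_ [ (r , P) ] b + coeff _≟_ xs b) + coeff _≟_ ys b ≈⟨ +-cong (coeff-∷ r P xs b) ≈-refl ⟨
      coeff _≟_ ((r , P) ∷ xs) b + coeff _≟_ ys b                 ∎

    private
      coeff-step-singletons : ∀ r P Q b → coeff _≟_ [ (r , P) ] b ≈
        coeff _≟_ [ (r , Q) ] b + (coeff _≟_ [ (- r * 1# , Q) ] b + (coeff _≟_ [ (- r * - 1# , P) ] b + 0#))
      coeff-step-singletons r P Q b with P ≟ b | Q ≟ b
      ... | yes _ | yes _ = begin
        r + 0#                                             ≈⟨ +-identityʳ _ ⟨
        (r + 0#) + 0#                                      ≈⟨ +-cong ≈-refl cancel ⟨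
        (r + 0#) + ((- r * 1# + 0#) + ((- r * - 1# + 0#) + 0#)) ∎
        where
        cancel : (- r * 1# + 0#) + ((- r * - 1# + 0#) + 0#) ≈ 0#
        cancel = ≈-trans (+-cong (≈-trans (+-identityʳ _) (-x*1≈-x r))
                                 (≈-trans (+-identityʳ _) (≈-trans (+-identityʳ _) (-x*-1≈x r)))) (-‿inverseˡ r)
      ... | yes _ | no _ = begin
        r + 0#                                             ≈⟨ +-identityʳ r ⟩
        r                                                  ≈⟨ -x*-1≈x r ⟨
        - r * - 1#                                         ≈⟨ ≈-trans (+-identityˡ _) (≈-trans (+-identityˡ _) (≈-trans (+-identityʳ _) (+-identityʳ _))) ⟨
        0# + (0# + ((- r * - 1# + 0#) + 0#))               ∎
      ... | no _ | yes _ = begin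
        0#                                                 ≈⟨ -‿inverseʳ r ⟨
        r + - r                                            ≈⟨ +-cong (+-identityʳ r) (≈-trans (+-identityʳ _) (≈-trans (+-identityʳ _) (-x*1≈-x r))) ⟨
        (r + 0#) + ((- r * 1# + 0#) + 0#)                  ≈⟨ +-cong ≈-refl (+-cong ≈-refl (+-identityʳ 0#)) ⟨
        (r + 0#) + ((- r * 1# + 0#) + (0# + 0#))           ∎
      ... | no _ | no _ = ≈-sym (≈-trans (+-identityˡ _) (≈-trans (+-identityˡ _) (+-identityʳ 0#)))

    -- the coefficient form of  r·P = r·Q + (-r)·(Q - P)
    coeff-generator-step : ∀ r P Q b →
      coeff _≟_ [ (r , P) ] b ≈ coeff _≟_ [ (r , Q) ] b + coeff _≟_ ((- r * 1# , Q) ∷ (- r * - 1# , P) ∷ []) b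
    coeff-generator-step r P Q b = ≈-trans (coeff-step-singletons r P Q b)
      (+-cong ≈-refl (≈-sym (≈-trans (coeff-∷ _ Q _ b) (+-cong ≈-refl (coeff-∷ _ P [] b)))))

    module _ {Gen : Set} (gen : Gen → LC B) where

      combo-++ : ∀ cs₁ cs₂ → combo gen (cs₁ ++ cs₂) ≡ combo gen cs₁ ++ combo gen cs₂
      combo-++ cs₁ cs₂ = concatMap-++ _ cs₁ cs₂

      EqMod-refl : ∀ x → EqMod _≟_ Gen gen x x
      EqMod-refl x = [] , λ b → ≈-sym (+-identityʳ _)

      EqMod-trans : ∀ {x y z} → EqMod _≟_ Gen gen x y → EqMod _≟_ Gen gen y z → EqMod _≟_ Gen gen x z
      EqMod-trans {x} {y} {z} (cs₁ , x≈y) (cs₂ , y≈z) = cs₂ ++ cs₁ , λ b → begin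
        coeff _≟_ x b                                                              ≈⟨ x≈y b ⟩
        coeff _≟_ y b + coeff _≟_ (combo gen cs₁) b                                ≈⟨ +-cong (y≈z b) ≈-refl ⟩
        (coeff _≟_ z b + coeff _≟_ (combo gen cs₂) b) + coeff _≟_ (combo gen cs₁) b ≈⟨ +-assoc _ _ _ ⟩
        coeff _≟_ z b + (coeff _≟_ (combo gen cs₂) b + coeff _≟_ (combo gen cs₁) b) ≈⟨ +-cong ≈-refl (coeff-++ (combo gen cs₂) (combo gen cs₁) b) ⟨
        coeff _≟_ z b + coeff _≟_ (combo gen cs₂ ++ combo gen cs₁) b               ≡⟨ cong (λ L → coeff _≟_ z b + coeff _≟_ L b) (combo-++ cs₂ cs₁) ⟨
        coeff _≟_ z b + coeff _≟_ (combo gen (cs₂ ++ cs₁)) b                       ∎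

      EqMod-++ : ∀ {x₁ y₁ x₂ y₂} → EqMod _≟_ Gen gen x₁ y₁ → EqMod _≟_ Gen gen x₂ y₂ → EqMod _≟_ Gen gen (x₁ ++ x₂) (y₁ ++ y₂)
      EqMod-++ {x₁} {y₁} {x₂} {y₂} (cs₁ , h₁) (cs₂ , h₂) = cs₁ ++ cs₂ , λ b → begin
        coeff _≟_ (x₁ ++ x₂) b                          ≈⟨ coeff-++ x₁ x₂ b ⟩
        coeff _≟_ x₁ b + coeff _≟_ x₂ b                 ≈⟨ +-cong (h₁ b) (h₂ b) ⟩
        (coeff _≟_ y₁ b + coeff _≟_ (combo gen cs₁) b) + (coeff _≟_ y₂ b + coeff _≟_ (combo gen cs₂) b)
          ≈⟨ interchange _ _ _ _ ⟩
        (coeff _≟_ y₁ b + coeff _≟_ y₂ b) + (coeff _≟_ (combo gen cs₁) b + coeff _≟_ (combo gen cs₂) b)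
          ≈⟨ +-cong (coeff-++ y₁ y₂ b) (coeff-++ (combo gen cs₁) (combo gen cs₂) b) ⟨
        coeff _≟_ (y₁ ++ y₂) b + coeff _≟_ (combo gen cs₁ ++ combo gen cs₂) b
          ≡⟨ cong (λ L → coeff _≟_ (y₁ ++ y₂) b + coeff _≟_ L b) (combo-++ cs₁ cs₂) ⟨
        coeff _≟_ (y₁ ++ y₂) b + coeff _≟_ (combo gen (cs₁ ++ cs₂)) b ∎

      EqMod-generator : ∀ r {P Q} g → gen g ≡ (1# , Q) ∷ (- 1# , P) ∷ [] → EqMod _≟_ Gen gen [ (r , P) ] [ (r , Q) ]
      EqMod-generator r {P} {Q} g gen-g = [ (- r , g) ] , λ b → begin
        coeff _≟_ [ (r , P) ] b                                                  ≈⟨ coeff-generator-step r P Q b ⟩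
        coeff _≟_ [ (r , Q) ] b + coeff _≟_ (scale (- r) ((1# , Q) ∷ (- 1# , P) ∷ [])) b
          ≡⟨ cong (λ L → coeff _≟_ [ (r , Q) ] b + coeff _≟_ L b) (trans (cong (scale (- r)) (sym gen-g)) (sym (++-identityʳ _))) ⟩
        coeff _≟_ [ (r , Q) ] b + coeff _≟_ (combo gen [ (- r , g) ]) b          ∎

    EqMod-reindex : ∀ {Gen Gen′ : Set} {gen : Gen → LC B} {gen′ : Gen′ → LC B} (embed : Gen → Gen′) →
      (∀ g → gen′ (embed g) ≡ gen g) → ∀ {x y} → EqMod _≟_ Gen gen x y → EqMod _≟_ Gen′ gen′ x y
    EqMod-reindex {gen = gen} {gen′} embed gen′∘embed {x} {y} (cs , h) =
      map (λ t → proj₁ t , embed (proj₂ t)) cs , λ b → ≈-trans (h b) (+-cong ≈-refl (≈-reflexive (cong (λ L → coeff _≟_ L b) (sym (combo-embed cs)))))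
      where
      combo-embed : ∀ cs → combo gen′ (map (λ t → proj₁ t , embed (proj₂ t)) cs) ≡ combo gen cs
      combo-embed []             = refl
      combo-embed ((r , g) ∷ cs) = cong₂ (λ G L → scale r G ++ L) (gen′∘embed g) (combo-embed cs)

  -- Δ(Φ x) and (Φ ⊗ Φ)(Δ x) term by term

  Term : Set c
  Term = Carrier × (Word × Word)

  sources : J₁Gen → Word
  sources g = map (λ t → proj₁ (proj₁ t)) g

  images : J₁Gen → Word
  images g = map (λ t → map (proj₁ (proj₂ t)) (proj₁ (proj₁ t))) g

  Relabelled : Word → Word → Set
  Relabelled A A′ = Σ J₁Gen λ g → (A ≡ images g) × (A′ ≡ sources g)

  RelabelledTerm : Term → Term → Set c
  RelabelledTerm (r , A , B) (r′ , A′ , B′) = (r ≡ r′) × Relabelled A A′ × Relabelled B B′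

  Relabelled-[] : Relabelled [] []
  Relabelled-[] = [] , refl , refl

  Relabelled-++ : ∀ {A A′ D D′} → Relabelled A A′ → Relabelled D D′ → Relabelled (A ++ D) (A′ ++ D′)
  Relabelled-++ (g , refl , refl) (h , refl , refl) = g ++ h , sym (map-++ _ g h) , sym (map-++ _ g h)

  Relabelled-C : ∀ u v → SamePattern (C u) v → Relabelled [ v ] [ C u ]
  Relabelled-C u v same =
    [ ((C u , C-cactus u) , relabelling (C u) v same , relabelling-injective (C u) v same) ] ,
    cong [_] (sym (map-relabelling (C u) v same)) , refl

  Relabelled-self : ∀ ω → Relabelled [ C ω ] [ C ω ]
  Relabelled-self ω = Relabelled-C ω (C ω) (refl , λ _ _ _ _ → (λ e → e) , (λ e → e))

  EqTT-relabelled : ∀ {t t′} → RelabelledTerm t t′ → EqTT J₁Gen J₁gen [ t ] [ t′ ]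
  EqTT-relabelled {r , _ , _} (refl , (gA , refl , refl) , (gB , refl , refl)) =
    EqMod-trans _≟WW_ (tensorGen J₁gen) {[ (r , images gA , images gB) ]} {[ (r , sources gA , images gB) ]} {[ (r , sources gA , sources gB) ]}
      (EqMod-generator _≟WW_ (tensorGen J₁gen) r (inj₁ (gA , images gB)) refl)
      (EqMod-generator _≟WW_ (tensorGen J₁gen) r (inj₂ (sources gA , gB)) refl)

  EqTT-pointwise : ∀ {X Y} → Pointwise RelabelledTerm X Y → EqTT J₁Gen J₁gen X Y
  EqTT-pointwise []                           = EqMod-refl _≟WW_ (tensorGen J₁gen) []
  EqTT-pointwise {t ∷ X} {t′ ∷ Y} (tt′ ∷ XY) =
    EqMod-++ _≟WW_ (tensorGen J₁gen) {[ t ]} {[ t′ ]} {X} {Y} (EqTT-relabelled tt′) (EqTT-pointwise XY)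

  mulTerm : Term → Term → Term
  mulTerm (r , A , B) (r′ , A′ , B′) = r * r′ , A ++ A′ , B ++ B′

  mulTerm-relabelled : ∀ {s s′ t t′} → RelabelledTerm s s′ → RelabelledTerm t t′ → RelabelledTerm (mulTerm s t) (mulTerm s′ t′)
  mulTerm-relabelled (e₁ , A₁ , B₁) (e₂ , A₂ , B₂) = cong₂ _*_ e₁ e₂ , Relabelled-++ A₁ A₂ , Relabelled-++ B₁ B₂

  mulTT-pointwise : ∀ {X X′ Y Y′} → Pointwise RelabelledTerm X X′ → Pointwise RelabelledTerm Y Y′ →
    Pointwise RelabelledTerm (mulTT X Y) (mulTT X′ Y′)
  mulTT-pointwise []       _  = []
  mulTT-pointwise (s ∷ ss) ts = ++⁺ (row s ts) (mulTT-pointwise ss ts)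
    where
    row : ∀ {s s′ Y Y′} → RelabelledTerm s s′ → Pointwise RelabelledTerm Y Y′ → Pointwise RelabelledTerm (map (mulTerm s) Y) (map (mulTerm s′) Y′)
    row s []       = []
    row s (t ∷ ts) = mulTerm-relabelled s t ∷ row s ts

  scale-pointwise : ∀ r {X Y} → Pointwise RelabelledTerm X Y → Pointwise RelabelledTerm (scale r X) (scale r Y)
  scale-pointwise r []                   = []
  scale-pointwise r ((e , A , B) ∷ ts) = (cong (r *_) e , A , B) ∷ scale-pointwise r ts

  C⊗C : Term → Term
  C⊗C (r , A , B) = r , map C A , map C B

  C⊗C-mulTerm : ∀ s t → C⊗C (mulTerm s t) ≡ mulTerm (C⊗C s) (C⊗C t)
  C⊗C-mulTerm (r , A , B) (r′ , A′ , B′) = cong₂ (λ X Y → r * r′ , X , Y) (map-++ C A A′) (map-++ C B B′)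

  Φ⊗Φ-mulTT : ∀ X Y → Φ⊗Φ (mulTT X Y) ≡ mulTT (Φ⊗Φ X) (Φ⊗Φ Y)
  Φ⊗Φ-mulTT []      Y = refl
  Φ⊗Φ-mulTT (s ∷ X) Y = trans (map-++ C⊗C (map (mulTerm s) Y) (mulTT X Y)) (cong₂ _++_ (row Y) (Φ⊗Φ-mulTT X Y))
    where
    row : ∀ Y → Φ⊗Φ (map (mulTerm s) Y) ≡ map (mulTerm (C⊗C s)) (Φ⊗Φ Y)
    row []      = refl
    row (t ∷ Y) = cong₂ _∷_ (C⊗C-mulTerm s t) (row Y)

  Φ⊗Φ-scale : ∀ r X → Φ⊗Φ (scale r X) ≡ scale r (Φ⊗Φ X)
  Φ⊗Φ-scale r []      = refl
  Φ⊗Φ-scale r (t ∷ X) = cong (_ ∷_) (Φ⊗Φ-scale r X)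

  upperCut-relabelled : ∀ ω {cs} → WellFormedCuts ω cs → Relabelled (upperCut (C ω) cs) (map C (upperCut ω cs))
  upperCut-relabelled ω {[]}            _  = Relabelled-[]
  upperCut-relabelled ω {(k , k') ∷ cs} wf = Relabelled-++
    (Relabelled-C (slice ω k k') (slice (C ω) k k') (LoopSlice.SamePattern-slice ω (proj₂ (wf (here refl))) (proj₁ (wf (here refl)))))
    (upperCut-relabelled ω (λ p∈ → wf (there p∈)))

  cutTerm : Walk → List Pair → Term
  cutTerm ω cs = 1# , [ lowerCut ω cs ] , upperCut ω cs

  cutTerm-relabelled : ∀ ω {cs} → ω ≢ [] → cs ∈ EAdC ω → RelabelledTerm (cutTerm (C ω) cs) (C⊗C (cutTerm ω cs))
  cutTerm-relabelled ω {cs} ω≢[] cs∈ with ∈EAdC⇒ ω cs∈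
  ... | _ , chain , wf = refl ,
    Relabelled-C (lowerCut ω cs) (lowerCut (C ω) cs) (LowerCut.SamePattern-lowerCut ω cs ω≢[] chain wf) ,
    upperCut-relabelled ω wf

  ΔWalk-C : ∀ ω → ω ≢ [] → Pointwise RelabelledTerm (ΔWalk (C ω)) (Φ⊗Φ (ΔWalk ω))
  ΔWalk-C ω ω≢[] = (refl , Relabelled-[] , Relabelled-self ω) ∷ (refl , Relabelled-self ω , Relabelled-[]) ∷
    subst (λ L → Pointwise RelabelledTerm (map (cutTerm (C ω)) L) (Φ⊗Φ (map (cutTerm ω) (EAdC ω)))) (sym (EAdC-C ω))
      (cuts (EAdC ω) (λ cs∈ → cs∈))
    where
    cuts : ∀ L → (∀ {cs} → cs ∈ L → cs ∈ EAdC ω) → Pointwise RelabelledTerm (map (cutTerm (C ω)) L) (Φ⊗Φ (map (cutTerm ω) L))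
    cuts []       _ = []
    cuts (cs ∷ L) ⊆ = cutTerm-relabelled ω ω≢[] (⊆ (here refl)) ∷ cuts L (λ cs∈ → ⊆ (there cs∈))

  ΔWord-C : ∀ G w → All.All (IsWalk G) w → Pointwise RelabelledTerm (ΔWord (map C w)) (Φ⊗Φ (ΔWord w))
  ΔWord-C G []      _                 = (refl , Relabelled-[] , Relabelled-[]) ∷ []
  ΔWord-C G (ω ∷ w) (ω-walk All.∷ ws) = subst (Pointwise RelabelledTerm (ΔWord (map C (ω ∷ w)))) (sym (Φ⊗Φ-mulTT (ΔWalk ω) (ΔWord w)))
    (mulTT-pointwise (ΔWalk-C ω (proj₁ ω-walk)) (ΔWord-C G w ws))

  Δ-Φ : ∀ G x → OnG G x → Pointwise RelabelledTerm (Δ (Φ x)) (Φ⊗Φ (Δ x))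
  Δ-Φ G []            _                = []
  Δ-Φ G ((r , w) ∷ x) (w-walks All.∷ xs) = subst (Pointwise RelabelledTerm (Δ (Φ ((r , w) ∷ x))))
    (sym (trans (map-++ C⊗C (scale r (ΔWord w)) (Δ x)) (cong (_++ Φ⊗Φ (Δ x)) (Φ⊗Φ-scale r (ΔWord w)))))
    (++⁺ (scale-pointwise r (ΔWord-C G w w-walks)) (Δ-Φ G x xs))

  ε-Φ : ∀ x → ε (Φ x) ≈ ε x
  ε-Φ []                  = ≈-refl
  ε-Φ ((r , [])    ∷ x) = +-cong ≈-refl (ε-Φ x)
  ε-Φ ((r , _ ∷ _) ∷ x) = ε-Φ x

  Φ-J₁-Hopf : ∀ G → IsHopfMorphismΦ G J₁Gen J₁gen
  Φ-J₁-Hopf G x x-on-G = EqTT-pointwise (Δ-Φ G x x-on-G) , ε-Φ x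

  Φ-J₂-Hopf : ∀ G → IsHopfMorphismΦ G J₂Gen J₂gen
  Φ-J₂-Hopf G x x-on-G =
    EqMod-reindex _≟WW_ {gen = tensorGen J₁gen} {gen′ = tensorGen J₂gen} J₁⊗→J₂⊗ (λ { (inj₁ _) → refl ; (inj₂ _) → refl })
      {Δ (Φ x)} {Φ⊗Φ (Δ x)} (proj₁ (Φ-J₁-Hopf G x x-on-G)) , ε-Φ x
    where
    J₁⊗→J₂⊗ : (J₁Gen × Word) ⊎ (Word × J₁Gen) → (J₂Gen × Word) ⊎ (Word × J₂Gen)
    J₁⊗→J₂⊗ (inj₁ (g , u)) = inj₁ (inj₂ g , u)
    J₁⊗→J₂⊗ (inj₂ (u , g)) = inj₂ (u , inj₂ g)

mainTheorem17 : {c ℓ : Level} (K : CommutativeRing c ℓ) → IsFieldChar0 K →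
    (G : Digraph) →
    Over.IsHopfMorphismΦ K G (Over.J₁Gen K) (Over.J₁gen K)
    × Over.IsHopfMorphismΦ K G (Over.J₂Gen K) (Over.J₂gen K)
mainTheorem17 K _ G = Φ-J₁-Hopf K G , Φ-J₂-Hopf K G
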